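{- There exist integers $a_1,\ldots,a_{173}$ and integers $n_1,\ldots,n_{173}$, each greater than $1$ and each dividing the odd number $3^3\times 5^2\times 7\times 11\times 13=675675$, such that the system of residue classes $\{a_s(n_s)\}_{s=1}^{173}$ is a cover of $\mathbb{Z}$, and there are distinct primes $p_1,\ldots,p_{173}$, all greater than $5$, such that for each $s\in\{1,\ldots,173\}$ the prime $p_s$ is a primitive prime divisor of $2^{n_s}-1$.
   Context: For $a\in\mathbb{Z}$ and $n\in\mathbb{Z}^+$, $a(n)=\{x\in\mathbb{Z}: x\equiv a \pmod n\}$. A finite system $\{a_s(n_s)\}_{s=1}^k$ of residue classes is a cover of $\mathbb{Z}$ if every integer belongs to at least one of the classes $a_s(n_s)$. For an integer $n>1$, a prime $p$ is a primitive prime divisor of $2^n-1$ if $p\mid 2^n-1$ but $p\nmid 2^m-1$ for every integer $0<m<n$. -}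

module Defs where

open import Data.Nat using (ℕ; _^_; _∸_; _<_; _*_)
open import Data.Nat.Divisibility using (_∣_)
open import Data.Nat.Primality using (Prime)
open import Data.Integer using (ℤ; +_; _-_)
import Data.Integer.Divisibility as ℤ∣
open import Data.Fin using (Fin)
open import Data.Product using (_×_; ∃)
open import Relation.Nullary using (¬_)

_∈Res_mod_ : ℤ → ℤ → ℕ → Set
x ∈Res a mod n = (+ n) ℤ∣.∣ (x - a)

Covers : (k : ℕ) → (Fin k → ℤ) → (Fin k → ℕ) → Set
Covers k a n = ∀ (x : ℤ) → ∃ λ (s : Fin k) → x ∈Res a s mod n s

PrimitivePrimeDivisor : ℕ → ℕ → Set
PrimitivePrimeDivisor p n =
  Prime p × (p ∣ (2 ^ n ∸ 1)) × (∀ (m : ℕ) → 0 < m → m < n → ¬ (p ∣ (2 ^ m ∸ 1)))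

N : ℕ
N = 3 * 3 * 3 * 5 * 5 * 7 * 11 * 13

{-# OPTIONS --safe #-}
module Submission where

-- Coverage is certified by a tree that splits a class
-- r (mod M) into the classes r + jM (mod qM), j < q, until every class lies inside some
-- a_s (mod n_s).  Each p_s is proved prime by Pocklington's criterion, which rests on Fermat's
-- little theorem, completed by trial division when p_s − 1 is only partly factored.  It is a
-- primitive divisor of 2^n_s − 1 because 2^n_s ≡ 1 but 2^(n_s/q) ≢ 1 (mod p_s) for every prime
-- q ∣ n_s, so that 2 has order exactly n_s modulo p_s.  The p_s are distinct because the table
-- lists them in increasing order.

open import Defs
open import Data.Bool using (Bool; true; false; T; not; _∧_; _∨_)
open import Data.Fin as Fin using (Fin; #_)
import Data.Fin.Properties as Fin
open import Data.Integer using (ℤ; +_)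
open import Data.List using (List; []; _∷_; map)
open import Data.List.Membership.Propositional using (_∈_)
open import Data.List.Relation.Unary.All as All using (All; []; _∷_)
open import Data.List.Relation.Unary.Any using (here; there)
open import Data.Nat using (ℕ; _<_; NonZero)
open import Data.Nat.Divisibility using (_∣_)
open import Data.Product using (Σ; ∃-syntax; _×_; _,_; proj₁; proj₂)
open import Data.Sum using (_⊎_; inj₁; inj₂; fromInj₂)
open import Data.Unit using (tt)
open import Data.Vec using (Vec; []; _∷_; lookup) renaming (map to mapᵥ)
open import Data.Vec.Functional using (Vector; init; tail; last)
open import Data.Vec.Properties using (lookup-map)
open import Data.Vec.Relation.Unary.All as Allᵥ using (all?)
open import Data.Vec.Relation.Unary.All.Properties using (lookup⁺)
open import Data.Vec.Relation.Unary.AllPairs as AllPairs using (AllPairs; allPairs?)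
open import Data.Vec.Relation.Unary.Unique.Propositional.Properties using (lookup-injective)
open import Function using (_∘_)
open import Function.Definitions using (Injective)
open import Relation.Binary.PropositionalEquality
open import Relation.Nullary using (Dec; ¬_; yes; no; does; ¬?; contradiction)
open import Relation.Nullary.Decidable using (map′; from-yes; _→-dec_; T?)

T-does⇒ : ∀ {A : Set} (a? : Dec A) → T (does a?) → A
T-does⇒ (yes a) _ = a

T-does∧⇒ : ∀ {A : Set} (a? : Dec A) {b} → T (does a? ∧ b) → A × T b
T-does∧⇒ (yes a) t = a , t

T-does∨⇒ : ∀ {A : Set} (a? : Dec A) {b} → T (does a? ∨ b) → A ⊎ T b
T-does∨⇒ (yes a) _ = inj₁ a
T-does∨⇒ (no _)  t = inj₂ t

T-not-does∧⇒ : ∀ {A : Set} (a? : Dec A) {b} → T (not (does a?) ∧ b) → ¬ A × T b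
T-not-does∧⇒ (no ¬a) t = ¬a , t

T-∧⇒ : ∀ x {y} → T (x ∧ y) → T x × T y
T-∧⇒ true t = _ , t

-- Covering certificates

module Covering where

  open import Data.Integer as ℤ using (_-_; _+_; _*_)
  import Data.Integer.Properties as ℤ
  open import Data.Integer.DivMod using (_%ℕ_; _/ℕ_; n%ℕd<d; a≡a%ℕn+[a/ℕn]*n)
  open import Data.Integer.Divisibility.Signed using (divides; ∣ᵤ⇒∣; ∣⇒∣ᵤ; ∣m∣n⇒∣m+n)
  import Data.Integer.Divisibility.Signed as ℤ∣
  open import Data.Integer.Tactic.RingSolver using (solve-∀)
  import Data.Nat as ℕ
  import Data.Nat.Divisibility as ℕ

  private
    [x-y]+[y-z]≡x-z : ∀ x y z → (x - y) + (y - z) ≡ x - z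
    [x-y]+[y-z]≡x-z = solve-∀

    x-[r+jM]≡[x-r]-jM : ∀ x r j M → x - (r + j * M) ≡ (x - r) - j * M
    x-[r+jM]≡[x-r]-jM = solve-∀

    [j+wq]M-jM≡w[Mq] : ∀ j w q M → (j + w * q) * M - j * M ≡ w * (M * q)
    [j+wq]M-jM≡w[Mq] = solve-∀

    r+[1+j]M≡[r+M]+jM : ∀ r j M → r + (+ 1 + j) * M ≡ (r + M) + j * M
    r+[1+j]M≡[r+M]+jM = solve-∀

  ∈Res-trans : ∀ {x y z n} → x ∈Res y mod n → y ∈Res z mod n → x ∈Res z mod n
  ∈Res-trans {x} {y} {z} {n} x≡y y≡z = ∣⇒∣ᵤ (subst (+ n ℤ∣.∣_) ([x-y]+[y-z]≡x-z x y z)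
    (∣m∣n⇒∣m+n (∣ᵤ⇒∣ {+ n} {x - y} x≡y) (∣ᵤ⇒∣ {+ n} {y - z} y≡z)))

  ∈Res-∣ : ∀ {x y m n} → n ∣ m → x ∈Res y mod m → x ∈Res y mod n
  ∈Res-∣ = ℕ.∣-trans

  ∈Res-refine : ∀ {x r M} q .{{_ : NonZero q}} → x ∈Res r mod M →
                ∃[ j ] j < q × x ∈Res (r + + j * + M) mod (M ℕ.* q)
  ∈Res-refine {x} {r} {M} q x≡r with ∣ᵤ⇒∣ {+ M} {x - r} x≡r
  ... | divides w x-r≡wM = j , n%ℕd<d w q , ∣⇒∣ᵤ {+ (M ℕ.* q)} {x - (r + + j * + M)} (divides w′ x-[r+jM]≡w′Mq)
    where
    open ≡-Reasoning
    j = w %ℕ q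
    w′ = w /ℕ q
    x-[r+jM]≡w′Mq : x - (r + + j * + M) ≡ w′ * + (M ℕ.* q)
    x-[r+jM]≡w′Mq = begin
      x - (r + + j * + M)                 ≡⟨ x-[r+jM]≡[x-r]-jM x r (+ j) (+ M) ⟩
      (x - r) - + j * + M                 ≡⟨ cong (λ y → y - + j * + M) x-r≡wM ⟩
      w * + M - + j * + M                 ≡⟨ cong (λ y → y * + M - + j * + M) (a≡a%ℕn+[a/ℕn]*n w q) ⟩
      (+ j + w′ * + q) * + M - + j * + M  ≡⟨ [j+wq]M-jM≡w[Mq] (+ j) w′ (+ q) (+ M) ⟩
      w′ * (+ M * + q)                    ≡⟨ cong (w′ *_) (ℤ.pos-* M q) ⟨
      w′ * + (M ℕ.* q)                    ∎

  -- Below a class r (mod M), node q ts hands r + jM (mod qM) to the j-th subtree, and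
  -- leaf s asserts that r (mod M) lies inside a_s (mod n_s).
  data CoverTree (k : ℕ) : Set where
    leaf : Fin k → CoverTree k
    node : (q : ℕ) .{{_ : NonZero q}} → Vec (CoverTree k) q → CoverTree k

  module _ {k} (a : Fin k → ℤ) (n : Fin k → ℕ) where

    mutual
      coversClass : ℕ → ℤ → CoverTree k → Bool
      coversClass M r (leaf s)    = does (n s ℕ.∣? M) ∧ does (n s ℕ.∣? ℤ.∣ r - a s ∣)
      coversClass M r (node q ts) = childrenCover (M ℕ.* q) M r ts

      childrenCover : ℕ → ℕ → ℤ → ∀ {l} → Vec (CoverTree k) l → Bool
      childrenCover Mq M r []       = true
      childrenCover Mq M r (t ∷ ts) = coversClass Mq r t ∧ childrenCover Mq M (r + + M) ts

    mutual
      coversClass-sound : ∀ M r t → T (coversClass M r t) →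
                          ∀ x → x ∈Res r mod M → ∃[ s ] x ∈Res a s mod n s
      coversClass-sound M r (leaf s) ok x x≡r =
        let n∣M , r≡a = T-does∧⇒ (n s ℕ.∣? M) ok
        in s , ∈Res-trans {x} {r} {a s} (∈Res-∣ {x} {r} n∣M x≡r) (T-does⇒ (n s ℕ.∣? _) r≡a)
      coversClass-sound M r (node q ts) ok x x≡r with ∈Res-refine {x} {r} {M} q x≡r
      ... | j , j<q , x≡r+jM = childrenCover-sound (M ℕ.* q) M r ts ok j j<q x x≡r+jM

      childrenCover-sound : ∀ Mq M r {l} (ts : Vec (CoverTree k) l) → T (childrenCover Mq M r ts) →
                            ∀ j → j < l → ∀ x → x ∈Res (r + + j * + M) mod Mq →
                            ∃[ s ] x ∈Res a s mod n s
      childrenCover-sound Mq M r (t ∷ ts) ok ℕ.zero    _            x x≡r      =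
        coversClass-sound Mq r t (proj₁ (T-∧⇒ (coversClass Mq r t) ok)) x
          (subst (λ y → x ∈Res y mod Mq) (ℤ.+-identityʳ r) x≡r)
      childrenCover-sound Mq M r (t ∷ ts) ok (ℕ.suc j) (ℕ.s<s j<l) x x≡r+M+jM =
        childrenCover-sound Mq M (r + + M) ts (proj₂ (T-∧⇒ (coversClass Mq r t) ok)) j j<l x
          (subst (λ y → x ∈Res y mod Mq) (r+[1+j]M≡[r+M]+jM r (+ j) (+ M)) x≡r+M+jM)

    cover : ∀ t → T (coversClass 1 (+ 0) t) → Covers k a n
    cover t ok x = coversClass-sound 1 (+ 0) t ok x (ℕ.1∣ _)

open Covering using (CoverTree; leaf; node; coversClass; cover)

open import Data.Nat
open import Data.Nat.Properties
open import Data.Nat.DivMod hiding (_mod_)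
open import Data.Nat.Divisibility
open import Data.Nat.GCD using (gcd; gcd[m,n]∣m; gcd[m,n]∣n; gcd-GCD; module Bézout)
open import Data.Nat.Coprimality using (Coprime; coprime?; coprime-divisor)
open import Data.Nat.Primality
open import Data.Nat.Primality.Factorisation using (factorise; factorisationHasAllPrimeFactors)
open import Data.Nat.ListAction using (product)
open import Data.Nat.Combinatorics using (_C_; nCn≡1; nCk≡n!/k![n-k]!; k![n∸k]!∣n!)
open import Data.Nat.Binary as ℕᵇ using (ℕᵇ; 2[1+_]; 1+[2_])
import Data.Nat.Binary.Properties as ℕᵇ
open import Algebra.Properties.CommutativeSemigroup +-commutativeSemigroup
  using () renaming (x∙yz≈y∙xz to x+[y+z]≡y+[x+z])
open import Algebra.Properties.CommutativeSemigroup *-commutativeSemigroup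
  using () renaming (xy∙z≈xz∙y to [xy]z≡[xz]y)
import Algebra.Properties.CommutativeSemiring.Binomial +-*-commutativeSemiring as Binomial
open import Algebra.Properties.Monoid.Sum +-0-monoid using (sum; sum-init-last)
open import Algebra.Definitions.RawSemiring +-*-rawSemiring using () renaming (_^_ to _^ᴿ_; _×_ to _×ᴿ_)

-- Congruences and fast exponentiation

infix 4 _≡_mod_
_≡_mod_ : ℕ → ℕ → (m : ℕ) → .{{NonZero m}} → Set
_≡_mod_ x y m = x % m ≡ y % m

module _ {m : ℕ} .{{_ : NonZero m}} where

  %-≡-mod : ∀ x → x % m ≡ x mod m
  %-≡-mod x = m%n%n≡m%n x m

  +-cong-mod : ∀ {x x′ y y′} → x ≡ x′ mod m → y ≡ y′ mod m → x + y ≡ x′ + y′ mod m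
  +-cong-mod {x} {x′} {y} {y′} x≡x′ y≡y′ = begin
    (x + y) % m             ≡⟨ %-distribˡ-+ x y m ⟩
    (x % m + y % m) % m     ≡⟨ cong₂ (λ a b → (a + b) % m) x≡x′ y≡y′ ⟩
    (x′ % m + y′ % m) % m   ≡⟨ %-distribˡ-+ x′ y′ m ⟨
    (x′ + y′) % m           ∎
    where open ≡-Reasoning

  *-cong-mod : ∀ {x x′ y y′} → x ≡ x′ mod m → y ≡ y′ mod m → x * y ≡ x′ * y′ mod m
  *-cong-mod {x} {x′} {y} {y′} x≡x′ y≡y′ = begin
    x * y % m                 ≡⟨ %-distribˡ-* x y m ⟩
    (x % m) * (y % m) % m     ≡⟨ cong₂ (λ a b → a * b % m) x≡x′ y≡y′ ⟩
    (x′ % m) * (y′ % m) % m   ≡⟨ %-distribˡ-* x′ y′ m ⟨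
    x′ * y′ % m               ∎
    where open ≡-Reasoning

  ^-cong-mod : ∀ {x y} k → x ≡ y mod m → x ^ k ≡ y ^ k mod m
  ^-cong-mod zero    x≡y = refl
  ^-cong-mod (suc k) x≡y = *-cong-mod x≡y (^-cong-mod k x≡y)

  ≡-mod⇒∣∸ : ∀ {x y} → x ≡ y mod m → m ∣ x ∸ y
  ≡-mod⇒∣∸ {x} {y} x≡y = divides (x / m ∸ y / m) (begin
    x ∸ y
      ≡⟨ cong₂ _∸_ (m≡m%n+[m/n]*n x m) (m≡m%n+[m/n]*n y m) ⟩
    (x % m + x / m * m) ∸ (y % m + y / m * m)
      ≡⟨ cong (λ r → (r + x / m * m) ∸ (y % m + y / m * m)) x≡y ⟩
    (y % m + x / m * m) ∸ (y % m + y / m * m)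
      ≡⟨ [m+n]∸[m+o]≡n∸o (y % m) _ _ ⟩
    x / m * m ∸ y / m * m
      ≡⟨ *-distribʳ-∸ m (x / m) (y / m) ⟨
    (x / m ∸ y / m) * m
      ∎)
    where open ≡-Reasoning

  ∣∸⇒≡-mod : ∀ {x y} → y ≤ x → m ∣ x ∸ y → x ≡ y mod m
  ∣∸⇒≡-mod {x} {y} y≤x m∣x∸y = begin
    x % m             ≡⟨ cong (_% m) (m∸n+n≡m y≤x) ⟨
    (x ∸ y + y) % m   ≡⟨ %-remove-+ˡ y m∣x∸y ⟩
    y % m             ∎
    where open ≡-Reasoning

  ≡-mod-∣ : ∀ {d x y} .{{_ : NonZero d}} → d ∣ m → x ≡ y mod m → x ≡ y mod d
  ≡-mod-∣ {d} {x} {y} d∣m x≡y = begin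
    x % d       ≡⟨ m∣n⇒o%n%m≡o%m d m x d∣m ⟨
    x % m % d   ≡⟨ cong (_% d) x≡y ⟩
    y % m % d   ≡⟨ m∣n⇒o%n%m≡o%m d m y d∣m ⟩
    y % d       ∎
    where open ≡-Reasoning

  ≡1-mod∧∣⇒≡1 : ∀ {x} → x ≡ 1 mod m → m ∣ x → m ≡ 1
  ≡1-mod∧∣⇒≡1 {x} x≡1 m∣x =
    ∣1⇒≡1 (m%n≡0⇒n∣m 1 m (trans (sym x≡1) (n∣m⇒m%n≡0 x m m∣x)))

module _ (m : ℕ) .{{_ : NonZero m}} where

  -- A function rather than a let, so that type checking evaluates the argument once.
  squareMod : ℕ → ℕ
  squareMod r = r * r % m

  powModᵇ : ℕ → ℕᵇ → ℕ
  powModᵇ b ℕᵇ.zero  = 1 % m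
  powModᵇ b 2[1+ e ] = squareMod (b * powModᵇ b e % m)
  powModᵇ b 1+[2 e ] = b * squareMod (powModᵇ b e) % m

  powModᵇ-correct : ∀ b e → powModᵇ b e ≡ b ^ ℕᵇ.toℕ e % m
  powModᵇ-correct b ℕᵇ.zero  = refl
  powModᵇ-correct b 2[1+ e ] = begin
      r * r % m                   ≡⟨ *-cong-mod {m} r≡ r≡ ⟩
      b ^ suc n * b ^ suc n % m   ≡⟨ cong (_% m) (^-distribˡ-+-* b (suc n) (suc n)) ⟨
      b ^ (suc n + suc n) % m     ≡⟨ cong (λ k → b ^ (suc n + k) % m) (+-identityʳ (suc n)) ⟨
      b ^ (2 * suc n) % m         ∎
    where
    open ≡-Reasoning
    n = ℕᵇ.toℕ e
    r = b * powModᵇ b e % m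
    r≡ : r ≡ b ^ suc n mod m
    r≡ = trans (%-≡-mod {m} _)
               (*-cong-mod {m} {b} refl (trans (cong (_% m) (powModᵇ-correct b e)) (%-≡-mod {m} _)))
  powModᵇ-correct b 1+[2 e ] = begin
      b * squareMod r % m         ≡⟨ *-cong-mod {m} {b} refl r²≡ ⟩
      b * (b ^ n * b ^ n) % m     ≡⟨ cong (λ k → b * k % m) (^-distribˡ-+-* b n n) ⟨
      b * b ^ (n + n) % m         ≡⟨ cong (λ k → b * b ^ (n + k) % m) (+-identityʳ n) ⟨
      b ^ suc (2 * n) % m         ∎
    where
    open ≡-Reasoning
    n = ℕᵇ.toℕ e
    r = powModᵇ b e
    r≡ : r ≡ b ^ n mod m
    r≡ = trans (cong (_% m) (powModᵇ-correct b e)) (%-≡-mod {m} _)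
    r²≡ : squareMod r ≡ b ^ n * b ^ n mod m
    r²≡ = trans (%-≡-mod {m} (r * r)) (*-cong-mod {m} r≡ r≡)

  powMod : ℕ → ℕ → ℕ
  powMod b e = powModᵇ b (ℕᵇ.fromℕ e)

  powMod-correct : ∀ b e → powMod b e ≡ b ^ e % m
  powMod-correct b e =
    trans (powModᵇ-correct b (ℕᵇ.fromℕ e)) (cong (λ k → b ^ k % m) (ℕᵇ.toℕ-fromℕ e))

  ^≡?-mod : ∀ x e y → Dec (x ^ e ≡ y mod m)
  ^≡?-mod x e y =
    map′ (trans (sym (powMod-correct x e))) (trans (powMod-correct x e)) (powMod x e ≟ y % m)

-- Multiplicative orders

∃-prime-divisor : ∀ {n} → n ≢ 1 → ∃[ q ] Prime q × q ∣ n
∃-prime-divisor {0}        _   = 2 , prime[2] , 2 ∣0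
∃-prime-divisor {1}        1≢1 = contradiction refl 1≢1
∃-prime-divisor {n@(2+ _)} _   with factorise n
... | record { factors = q ∷ qs ; isFactorisation = n≡q*qs ; factorsPrime = q-prime ∷ _ } =
  q , q-prime , divides (product qs) (trans n≡q*qs (*-comm q (product qs)))

module _ {m : ℕ} .{{_ : NonZero m}} {x : ℕ} where

  ^≡1-mod-∣ : ∀ {d c} → d ∣ c → x ^ d ≡ 1 mod m → x ^ c ≡ 1 mod m
  ^≡1-mod-∣ {d} (divides-refl k) xᵈ≡1 = begin
    x ^ (k * d) % m   ≡⟨ cong (λ e → x ^ e % m) (*-comm k d) ⟩
    x ^ (d * k) % m   ≡⟨ cong (_% m) (^-*-assoc x d k) ⟨
    (x ^ d) ^ k % m   ≡⟨ ^-cong-mod {m} k xᵈ≡1 ⟩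
    1 ^ k % m         ≡⟨ cong (_% m) (^-zeroˡ k) ⟩
    1 % m             ∎
    where open ≡-Reasoning

  ^≡1-mod-+ : ∀ {a b} → x ^ (a + b) ≡ 1 mod m → x ^ b ≡ 1 mod m → x ^ a ≡ 1 mod m
  ^≡1-mod-+ {a} {b} xᵃ⁺ᵇ≡1 xᵇ≡1 = begin
    x ^ a % m           ≡⟨ cong (_% m) (*-identityʳ (x ^ a)) ⟨
    x ^ a * 1 % m       ≡⟨ *-cong-mod {m} {x ^ a} refl xᵇ≡1 ⟨
    x ^ a * x ^ b % m   ≡⟨ cong (_% m) (^-distribˡ-+-* x a b) ⟨
    x ^ (a + b) % m     ≡⟨ xᵃ⁺ᵇ≡1 ⟩
    1 % m               ∎
    where open ≡-Reasoning

  ^≡1-mod-gcd : ∀ {a b} → x ^ a ≡ 1 mod m → x ^ b ≡ 1 mod m → x ^ gcd a b ≡ 1 mod m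
  ^≡1-mod-gcd {a} {b} xᵃ≡1 xᵇ≡1 with Bézout.identity (gcd-GCD a b)
  ... | Bézout.+- u v g+vb≡ua = ^≡1-mod-+ {gcd a b} {v * b}
    (^≡1-mod-∣ (divides u g+vb≡ua) xᵃ≡1) (^≡1-mod-∣ (divides v refl) xᵇ≡1)
  ... | Bézout.-+ u v g+ua≡vb = ^≡1-mod-+ {gcd a b} {u * a}
    (^≡1-mod-∣ (divides v g+ua≡vb) xᵇ≡1) (^≡1-mod-∣ (divides u refl) xᵃ≡1)

  ^≡1-mod⇒∣ : ∀ {F M k} → F ∣ M → x ^ M ≡ 1 mod m →
              (∀ q .{{_ : NonZero q}} → Prime q → q ∣ F → ¬ x ^ (M / q) ≡ 1 mod m) →
              x ^ k ≡ 1 mod m → F ∣ k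
  ^≡1-mod⇒∣ {F} {M} {k} F∣M xᴹ≡1 xᴹᐟᑫ≢1 xᵏ≡1 = ∣-trans F∣g (gcd[m,n]∣n M k)
    where
    g = gcd M k
    g∣M = gcd[m,n]∣m M k
    t = quotient g∣M

    -- M = t g with x^g ≡ 1, so a prime q dividing F and t would give x^(M/q) = (x^g)^(t/q) ≡ 1.
    F⊥t : Coprime F t
    F⊥t {i} (i∣F , i∣t) with i ≟ 1
    ... | yes i≡1 = i≡1
    ... | no  i≢1 with ∃-prime-divisor i≢1
    ...   | q , q-prime , q∣i = contradiction xᴹᐟᑫ≡1 (xᴹᐟᑫ≢1 q q-prime (∣-trans q∣i i∣F))
      where
      instance _ = prime⇒nonZero q-prime
      t′ = quotient (∣-trans q∣i i∣t)
      M/q≡t′*g : M / q ≡ t′ * g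
      M/q≡t′*g = begin
        M / q            ≡⟨ cong (_/ q) (m∣n⇒n≡quotient*m g∣M) ⟩
        t * g / q        ≡⟨ cong (λ s → s * g / q) (m∣n⇒n≡quotient*m (∣-trans q∣i i∣t)) ⟩
        t′ * q * g / q   ≡⟨ cong (_/ q) ([xy]z≡[xz]y t′ q g) ⟩
        t′ * g * q / q   ≡⟨ m*n/n≡m (t′ * g) q ⟩
        t′ * g           ∎
        where open ≡-Reasoning
      xᴹᐟᑫ≡1 : x ^ (M / q) ≡ 1 mod m
      xᴹᐟᑫ≡1 = ^≡1-mod-∣ (divides t′ M/q≡t′*g) (^≡1-mod-gcd {M} {k} xᴹ≡1 xᵏ≡1)

    F∣g : F ∣ g
    F∣g = coprime-divisor F⊥t (subst (F ∣_) (m∣n⇒n≡quotient*m g∣M) F∣M)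

primitive-prime-divisor : ∀ {p n} .{{_ : NonZero p}} → Prime p → 2 ^ n ≡ 1 mod p →
                          (∀ q .{{_ : NonZero q}} → Prime q → q ∣ n → ¬ 2 ^ (n / q) ≡ 1 mod p) →
                          PrimitivePrimeDivisor p n
primitive-prime-divisor {p} p-prime 2ⁿ≡1 2ⁿᐟᑫ≢1 = p-prime , ≡-mod⇒∣∸ {p} 2ⁿ≡1 , λ m 0<m m<n p∣2ᵐ∸1 →
  let 2ᵐ≡1 = ∣∸⇒≡-mod {p} (m^n>0 2 m) p∣2ᵐ∸1
  in <⇒≱ m<n (∣⇒≤ {{>-nonZero 0<m}} (^≡1-mod⇒∣ ∣-refl 2ⁿ≡1 2ⁿᐟᑫ≢1 2ᵐ≡1))

-- Fermat's little theorem

p∣n!⇒p≤n : ∀ {p n} → Prime p → p ∣ n ! → p ≤ n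
p∣n!⇒p≤n {n = zero}  p-prime p∣1 =
  contradiction (∣1⇒≡1 p∣1) (nonTrivial⇒≢1 {{prime⇒nonTrivial p-prime}})
p∣n!⇒p≤n {n = suc n} p-prime p∣n! with euclidsLemma (suc n) (n !) p-prime p∣n!
... | inj₁ p∣1+n = ∣⇒≤ p∣1+n
... | inj₂ p∣n!′ = m≤n⇒m≤1+n (p∣n!⇒p≤n p-prime p∣n!′)

n!≡nCk*k!*[n∸k]! : ∀ {n k} → k ≤ n → n ! ≡ (n C k) * (k ! * (n ∸ k) !)
n!≡nCk*k!*[n∸k]! {n} {k} k≤n = begin
  n !                                          ≡⟨ m/n*n≡m (k![n∸k]!∣n! k≤n) ⟨
  n ! / (k ! * (n ∸ k) !) * (k ! * (n ∸ k) !)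
    ≡⟨ cong (_* (k ! * (n ∸ k) !)) (nCk≡n!/k![n-k]! k≤n) ⟨
  (n C k) * (k ! * (n ∸ k) !)                  ∎
  where
  open ≡-Reasoning
  instance _ = k !* (n ∸ k) !≢0

p∣pCk : ∀ {p k} → Prime p → 0 < k → k < p → p ∣ p C k
p∣pCk {p@(suc p-1)} {k} p-prime 0<k k<p with euclidsLemma (p C k) (k ! * (p ∸ k) !) p-prime
  (subst (p ∣_) (n!≡nCk*k!*[n∸k]! (<⇒≤ k<p)) (m∣m*n (p-1 !)))
... | inj₁ p∣pCk = p∣pCk
... | inj₂ p∣k![p∸k]! with euclidsLemma (k !) ((p ∸ k) !) p-prime p∣k![p∸k]!
...   | inj₁ p∣k!     = contradiction (p∣n!⇒p≤n p-prime p∣k!) (<⇒≱ k<p)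
...   | inj₂ p∣[p∸k]! =
  contradiction (p∣n!⇒p≤n p-prime p∣[p∸k]!) (<⇒≱ (∸-monoʳ-< 0<k (<⇒≤ k<p)))

^ᴿ≗^ : ∀ x n → x ^ᴿ n ≡ x ^ n
^ᴿ≗^ x zero    = refl
^ᴿ≗^ x (suc n) = cong (x *_) (^ᴿ≗^ x n)

×ᴿ≗* : ∀ n x → n ×ᴿ x ≡ n * x
×ᴿ≗* zero    x = refl
×ᴿ≗* (suc n) x = cong (λ y → x + y) (×ᴿ≗* n x)

∣-sum : ∀ {d n} (t : Vector ℕ n) → (∀ i → d ∣ t i) → d ∣ sum t
∣-sum {n = zero}  t d∣t = _ ∣0
∣-sum {n = suc n} t d∣t = ∣m∣n⇒∣m+n (d∣t Fin.zero) (∣-sum (tail t) (d∣t ∘ Fin.suc))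

freshmans-dream : ∀ {p} .{{_ : NonZero p}} → Prime p → ∀ x → (1 + x) ^ p ≡ x ^ p + 1 mod p
freshmans-dream {p@(suc p-1)} p-prime x =
  trans (cong (_% p) expansion) (%-remove-+ˡ (x ^ p + 1) (∣-sum _ middle))
  where
  open ≡-Reasoning
  -- The library's k-th binomial term of (1 + x)^p is (p C k) × (1^k * x^(p − k)).
  t = Binomial.binomialTerm 1 x p
  first : t Fin.zero ≡ x ^ p
  first = trans (×ᴿ≗* 1 _) (trans (*-identityˡ _) (trans (*-identityˡ _) (^ᴿ≗^ x p)))
  final : last (tail t) ≡ 1
  final = begin
    last (tail t)
      ≡⟨ cong (λ k → (p C suc k) ×ᴿ (1 ^ᴿ suc k * x ^ᴿ (p-1 ∸ k))) (Fin.toℕ-fromℕ p-1) ⟩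
    (p C p) ×ᴿ (1 ^ᴿ p * x ^ᴿ (p-1 ∸ p-1))
      ≡⟨ cong₂ (λ c k → c ×ᴿ (1 ^ᴿ p * x ^ᴿ k)) (nCn≡1 p) (n∸n≡0 p-1) ⟩
    1 ×ᴿ (1 ^ᴿ p * 1)
      ≡⟨ trans (×ᴿ≗* 1 _) (trans (*-identityˡ _) (trans (*-identityʳ _) (^ᴿ≗^ 1 p))) ⟩
    1 ^ p
      ≡⟨ ^-zeroˡ p ⟩
    1 ∎
  middle : ∀ i → p ∣ init (tail t) i
  middle i = subst (p ∣_) (sym (×ᴿ≗* (p C k) (Binomial.binomial 1 x p (Fin.suc (Fin.inject₁ i)))))
                   (∣m⇒∣m*n _ (p∣pCk p-prime z<s (s<s k-1<p-1)))
    where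
    k = suc (Fin.toℕ (Fin.inject₁ i))
    k-1<p-1 = subst (_< p-1) (sym (Fin.toℕ-inject₁ i)) (Fin.toℕ<n i)
  expansion : (1 + x) ^ p ≡ sum (init (tail t)) + (x ^ p + 1)
  expansion = begin
    (1 + x) ^ p                                    ≡⟨ ^ᴿ≗^ (1 + x) p ⟨
    (1 + x) ^ᴿ p                                   ≡⟨ Binomial.theorem p 1 x ⟩
    t Fin.zero + sum (tail t)                      ≡⟨ cong₂ _+_ first (sum-init-last (tail t)) ⟩
    x ^ p + (sum (init (tail t)) + last (tail t))  ≡⟨ cong (λ l → x ^ p + (sum (init (tail t)) + l)) final ⟩
    x ^ p + (sum (init (tail t)) + 1)              ≡⟨ x+[y+z]≡y+[x+z] (x ^ p) _ 1 ⟩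
    sum (init (tail t)) + (x ^ p + 1)              ∎

module _ {p} .{{_ : NonZero p}} (p-prime : Prime p) where

  fermat-little : ∀ x → x ^ p ≡ x mod p
  fermat-little zero    = cong (_% p) (0^n≡0 p)
    where
    0^n≡0 : ∀ n .{{_ : NonZero n}} → 0 ^ n ≡ 0
    0^n≡0 (suc n) = refl
  fermat-little (suc x) = begin
    (1 + x) ^ p % p   ≡⟨ freshmans-dream p-prime x ⟩
    (x ^ p + 1) % p   ≡⟨ +-cong-mod {p} (fermat-little x) refl ⟩
    (x + 1) % p       ≡⟨ cong (_% p) (+-comm x 1) ⟩
    (1 + x) % p       ∎
    where open ≡-Reasoning

  fermat-little-∤ : ∀ {x} → ¬ p ∣ x → x ^ (p ∸ 1) ≡ 1 mod p
  fermat-little-∤ {x} p∤x = ∣∸⇒≡-mod {p} (m^n>0 x {{≢-nonZero x≢0}} (p ∸ 1)) p∣xᵖ⁻¹∸1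
    where
    x≢0 : x ≢ 0
    x≢0 refl = p∤x (p ∣0)
    xᵖ∸x≡x[xᵖ⁻¹∸1] : x ^ p ∸ x ≡ x * (x ^ (p ∸ 1) ∸ 1)
    xᵖ∸x≡x[xᵖ⁻¹∸1] = begin
      x ^ p ∸ x                 ≡⟨ cong₂ _∸_ (xⁿ≡x*xⁿ⁻¹ p) (sym (*-identityʳ x)) ⟩
      x * x ^ (p ∸ 1) ∸ x * 1   ≡⟨ *-distribˡ-∸ x (x ^ (p ∸ 1)) 1 ⟨
      x * (x ^ (p ∸ 1) ∸ 1)     ∎
      where
      open ≡-Reasoning
      xⁿ≡x*xⁿ⁻¹ : ∀ n .{{_ : NonZero n}} → x ^ n ≡ x * x ^ (n ∸ 1)
      xⁿ≡x*xⁿ⁻¹ (suc n) = refl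
    p∣xᵖ⁻¹∸1 : p ∣ x ^ (p ∸ 1) ∸ 1
    p∣xᵖ⁻¹∸1 = fromInj₂ (λ p∣x → contradiction p∣x p∤x)
      (euclidsLemma x _ p-prime (subst (p ∣_) xᵖ∸x≡x[xᵖ⁻¹∸1] (≡-mod⇒∣∸ {p} (fermat-little x))))

-- Pocklington's criterion

∣⇒∣^ : ∀ {d x} k .{{_ : NonZero k}} → d ∣ x → d ∣ x ^ k
∣⇒∣^ (suc k) d∣x = ∣m⇒∣m*n _ d∣x

-- The gcd condition is stated for a^((p − 1)/q) reduced mod p, the value a certificate computes.
pocklington : ∀ {p a F} .{{_ : NonZero p}} → F ∣ p ∸ 1 → a ^ (p ∸ 1) ≡ 1 mod p →
              (∀ q .{{_ : NonZero q}} → Prime q → q ∣ F → Coprime (a ^ ((p ∸ 1) / q) % p ∸ 1) p) →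
              ∀ {r} → Prime r → r ∣ p → F ∣ r ∸ 1
pocklington {p} {a} {F} F∣p∸1 aᵖ⁻¹≡1 coprime {r} r-prime r∣p =
  ^≡1-mod⇒∣ {r} {a} F∣p∸1 aᵖ⁻¹≡1[r] aᵖ⁻¹ᐟᑫ≢1[r] (fermat-little-∤ r-prime r∤a)
  where
  instance _ = prime⇒nonZero r-prime
  r≢1 : r ≢ 1
  r≢1 = nonTrivial⇒≢1 {{prime⇒nonTrivial r-prime}}
  aᵖ⁻¹≡1[r] : a ^ (p ∸ 1) ≡ 1 mod r
  aᵖ⁻¹≡1[r] = ≡-mod-∣ {p} r∣p aᵖ⁻¹≡1
  r∤a : ¬ r ∣ a
  r∤a r∣a = r≢1 (≡1-mod∧∣⇒≡1 aᵖ⁻¹≡1[r] (∣⇒∣^ (p ∸ 1) {{p∸1≢0}} r∣a))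
    where
    p∸1≢0 : NonZero (p ∸ 1)
    p∸1≢0 = >-nonZero (m<n⇒0<n∸m (<-≤-trans (nonTrivial⇒n>1 r {{prime⇒nonTrivial r-prime}}) (∣⇒≤ r∣p)))
  aᵖ⁻¹ᐟᑫ≢1[r] : ∀ q .{{_ : NonZero q}} → Prime q → q ∣ F → ¬ a ^ ((p ∸ 1) / q) ≡ 1 mod r
  aᵖ⁻¹ᐟᑫ≢1[r] q q-prime q∣F aᵖ⁻¹ᐟᑫ≡1[r] = r≢1 (coprime q q-prime q∣F (r∣c∸1 , r∣p))
    where
    r∣c∸1 : r ∣ a ^ ((p ∸ 1) / q) % p ∸ 1
    r∣c∸1 = ≡-mod⇒∣∸ {r} (trans (≡-mod-∣ {p} r∣p (%-≡-mod {p} _)) aᵖ⁻¹ᐟᑫ≡1[r])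

small-prime-divisor-of-* : ∀ {d e} → 1 < d → 1 < e → ∃[ r ] Prime r × r ∣ d * e × r * r ≤ d * e
small-prime-divisor-of-* {d@(2+ _)} {e@(2+ _)} sz<ss sz<ss
  with ∃-prime-divisor (nonTrivial⇒≢1 {d}) | ∃-prime-divisor (nonTrivial⇒≢1 {e})
... | r , r-prime , r∣d | s , s-prime , s∣e with ≤-total r s
...   | inj₁ r≤s = r , r-prime , ∣m⇒∣m*n e r∣d , ≤-trans (*-monoʳ-≤ r r≤s) (*-mono-≤ (∣⇒≤ r∣d) (∣⇒≤ s∣e))
...   | inj₂ s≤r = s , s-prime , ∣n⇒∣m*n d s∣e , ≤-trans (*-monoˡ-≤ s s≤r) (*-mono-≤ (∣⇒≤ r∣d) (∣⇒≤ s∣e))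

composite⇒small-prime-divisor : ∀ {n} → Composite n → ∃[ r ] Prime r × r ∣ n × r * r ≤ n
composite⇒small-prime-divisor (hasNonTrivialDivisor {d} d<n d∣n) =
  subst (λ m → ∃[ r ] Prime r × r ∣ m × r * r ≤ m) (sym (m∣n⇒n≡quotient*m d∣n))
    (small-prime-divisor-of-* (quotient>1 d∣n d<n) (nonTrivial⇒n>1 d))

large-prime-divisors⇒prime : ∀ {p} → 1 < p → (∀ {r} → Prime r → r ∣ p → p < r * r) → Prime p
large-prime-divisors⇒prime 1<p large = prime {{n>1⇒nonTrivial 1<p}} λ composite →
  let r , r-prime , r∣p , r²≤p = composite⇒small-prime-divisor composite
  in <⇒≱ (large r-prime r∣p) r²≤p

pocklington-prime : ∀ {p a F} .{{_ : NonZero p}} → 1 < p → F ∣ p ∸ 1 → a ^ (p ∸ 1) ≡ 1 mod p →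
                    (∀ q .{{_ : NonZero q}} → Prime q → q ∣ F → Coprime (a ^ ((p ∸ 1) / q) % p ∸ 1) p) →
                    (∀ k → 0 < k → (1 + F * k) * (1 + F * k) ≤ p → ¬ 1 + F * k ∣ p) → Prime p
pocklington-prime {p} {a} {F} 1<p F∣p∸1 aᵖ⁻¹≡1 coprime no-small-divisor =
  large-prime-divisors⇒prime 1<p large
  where
  large : ∀ {r} → Prime r → r ∣ p → p < r * r
  large {r@(suc r-1)} r-prime r∣p with pocklington F∣p∸1 aᵖ⁻¹≡1 coprime r-prime r∣p
  ... | divides zero    r-1≡0   =
    contradiction (cong suc r-1≡0) (nonTrivial⇒≢1 {{prime⇒nonTrivial r-prime}})
  ... | divides (suc k) r-1≡k*F =
    ≰⇒> λ r²≤p → no-small-divisor (suc k) z<s (subst (λ s → s * s ≤ p) r≡ r²≤p) (subst (_∣ p) r≡ r∣p)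
    where
    r≡ : r ≡ 1 + F * suc k
    r≡ = cong suc (trans r-1≡k*F (*-comm (suc k) F))

noDivisorOfForm : (fuel F p k : ℕ) → Bool
noDivisorOfForm zero       F p k = false
noDivisorOfForm (suc fuel) F p k =
  does (p <? d * d) ∨ (not (does (d ∣? p)) ∧ noDivisorOfForm fuel F p (suc k))
  where d = 1 + F * k

noDivisorOfForm-sound : ∀ fuel F p k → T (noDivisorOfForm fuel F p k) →
                        ∀ j → k ≤ j → (1 + F * j) * (1 + F * j) ≤ p → ¬ 1 + F * j ∣ p
noDivisorOfForm-sound (suc fuel) F p k ok j k≤j dⱼ²≤p with T-does∨⇒ (p <? (1 + F * k) * (1 + F * k)) ok
... | inj₁ p<dₖ² = contradiction (≤-trans (*-mono-≤ dₖ≤dⱼ dₖ≤dⱼ) dⱼ²≤p) (<⇒≱ p<dₖ²)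
  where dₖ≤dⱼ = s≤s (*-monoʳ-≤ F k≤j)
... | inj₂ ok′ with T-not-does∧⇒ (1 + F * k ∣? p) ok′ | m≤n⇒m<n∨m≡n k≤j
...   | dₖ∤p , _  | inj₂ refl = dₖ∤p
...   | _    , ok″ | inj₁ k<j  = noDivisorOfForm-sound fuel F p (suc k) ok″ j k<j dⱼ²≤p

-- cert p a qs: a is the Pocklington witness and qs certify primes whose product F divides
-- p − 1; the prime divisors ≡ 1 (mod F) below √p are excluded by trial division, so that
-- cert p 1 [] is plain trial division.
data PrimeCertificate : Set where
  cert : (p a : ℕ) → List PrimeCertificate → PrimeCertificate

certified : PrimeCertificate → ℕ
certified (cert p _ _) = p

factorProduct : List PrimeCertificate → ℕ
factorProduct qs = product (map certified qs)

coprimeCheck : (p : ℕ) .{{_ : NonZero p}} → ℕ → ℕ → Bool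
coprimeCheck p a zero      = false
coprimeCheck p a q@(suc _) = does (coprime? (powMod p a ((p ∸ 1) / q) ∸ 1) p)

mutual
  isCertified : PrimeCertificate → Bool
  isCertified (cert 0 _ _)         = false
  isCertified (cert 1 _ _)         = false
  isCertified (cert p@(2+ _) a qs) =
    does (^≡?-mod p a (p ∸ 1) 1) ∧ does (factorProduct qs ∣? p ∸ 1) ∧
    noDivisorOfForm p (factorProduct qs) p 1 ∧ factorsCertified p a qs

  factorsCertified : (p : ℕ) .{{_ : NonZero p}} → ℕ → List PrimeCertificate → Bool
  factorsCertified p a []       = true
  factorsCertified p a (c ∷ cs) = isCertified c ∧ coprimeCheck p a (certified c) ∧ factorsCertified p a cs

coprimeCheck-sound : ∀ {p} .{{_ : NonZero p}} {a} q .{{_ : NonZero q}} → T (coprimeCheck p a q) →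
                     Coprime (a ^ ((p ∸ 1) / q) % p ∸ 1) p
coprimeCheck-sound {p} {a = a} q@(suc _) ok =
  subst (λ c → Coprime (c ∸ 1) p) (powMod-correct p a ((p ∸ 1) / q)) (T-does⇒ (coprime? _ p) ok)

mutual
  isCertified-sound : ∀ c → T (isCertified c) → Prime (certified c)
  isCertified-sound (cert p@(2+ _) a qs) ok =
    let aᵖ⁻¹≡1 , ok       = T-does∧⇒ (^≡?-mod p a (p ∸ 1) 1) ok
        F∣p∸1 , ok        = T-does∧⇒ (factorProduct qs ∣? p ∸ 1) ok
        none , factors-ok = T-∧⇒ (noDivisorOfForm p (factorProduct qs) p 1) ok
        factors           = factorsCertified-sound qs factors-ok
        coprime : ∀ q .{{_ : NonZero q}} → Prime q → q ∣ factorProduct qs →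
                  Coprime (a ^ ((p ∸ 1) / q) % p ∸ 1) p
        coprime q q-prime q∣F = coprimeCheck-sound q
          (proj₂ (All.lookup factors (factorisationHasAllPrimeFactors q-prime q∣F (All.map proj₁ factors))))
    in pocklington-prime sz<ss F∣p∸1 aᵖ⁻¹≡1 coprime (noDivisorOfForm-sound p (factorProduct qs) p 1 none)

  factorsCertified-sound : ∀ {p} .{{_ : NonZero p}} {a} cs → T (factorsCertified p a cs) →
                           All (λ q → Prime q × T (coprimeCheck p a q)) (map certified cs)
  factorsCertified-sound []       _  = []
  factorsCertified-sound (c ∷ cs) ok =
    let c-ok , ok     = T-∧⇒ (isCertified c) ok
        c-cop , rest  = T-∧⇒ (coprimeCheck _ _ (certified c)) ok
    in (isCertified-sound c c-ok , c-cop) ∷ factorsCertified-sound cs rest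

N-factors : List ℕ
N-factors = 3 ∷ 3 ∷ 3 ∷ 5 ∷ 5 ∷ 7 ∷ 11 ∷ 13 ∷ []

prime∣N⇒∈N-factors : ∀ {q} → Prime q → q ∣ N → q ∈ N-factors
prime∣N⇒∈N-factors q-prime q∣N =
  factorisationHasAllPrimeFactors q-prime q∣N (from-yes (All.all? prime? N-factors))

orderCheck : (p : ℕ) .{{_ : NonZero p}} → ℕ → List ℕ → Bool
orderCheck p n []               = true
orderCheck p n (zero ∷ qs)      = false
orderCheck p n (q@(suc _) ∷ qs) = does (q ∣? n →-dec ¬? (^≡?-mod p 2 (n / q) 1)) ∧ orderCheck p n qs

orderCheck-sound : ∀ {p} .{{_ : NonZero p}} {n} qs → T (orderCheck p n qs) →
                   ∀ q .{{_ : NonZero q}} → q ∈ qs → q ∣ n → ¬ 2 ^ (n / q) ≡ 1 mod p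
orderCheck-sound {p} {n} (q@(suc _) ∷ qs) ok _ (here refl) =
  proj₁ (T-does∧⇒ (q ∣? n →-dec ¬? (^≡?-mod p 2 (n / q) 1)) ok)
orderCheck-sound {p} {n} (q@(suc _) ∷ qs) ok r (there r∈qs) =
  orderCheck-sound qs (proj₂ (T-does∧⇒ (q ∣? n →-dec ¬? (^≡?-mod p 2 (n / q) 1)) ok)) r r∈qs

primitiveCheck : ℕ → ℕ → Bool
primitiveCheck zero      n = false
primitiveCheck p@(suc _) n = does (^≡?-mod p 2 n 1) ∧ orderCheck p n N-factors

primitiveCheck-sound : ∀ {p n} → Prime p → n ∣ N → T (primitiveCheck p n) → PrimitivePrimeDivisor p n
primitiveCheck-sound {p@(suc _)} {n} p-prime n∣N ok =
  let 2ⁿ≡1 , order-ok = T-does∧⇒ (^≡?-mod p 2 n 1) ok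
  in primitive-prime-divisor p-prime 2ⁿ≡1 λ q q-prime q∣n →
       orderCheck-sound N-factors order-ok q (prime∣N⇒∈N-factors q-prime (∣-trans q∣n n∣N)) q∣n

record Row : Set where
  constructor row
  field
    modulus residue : ℕ
    certificate     : PrimeCertificate

  primeDivisor : ℕ
  primeDivisor = certified certificate

open Row

rowCheck : Row → Bool
rowCheck (row n a c) =
  does (1 <? n) ∧ does (n ∣? N) ∧ does (5 <? certified c) ∧ isCertified c ∧ primitiveCheck (certified c) n

ValidRow : Row → Set
ValidRow r = 1 < modulus r × modulus r ∣ N ×
             5 < primeDivisor r × PrimitivePrimeDivisor (primeDivisor r) (modulus r)

rowCheck-sound : ∀ r → T (rowCheck r) → ValidRow r
rowCheck-sound (row n a c) ok =
  let 1<n , ok            = T-does∧⇒ (1 <? n) ok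
      n∣N , ok            = T-does∧⇒ (n ∣? N) ok
      5<p , ok            = T-does∧⇒ (5 <? certified c) ok
      c-ok , primitive-ok = T-∧⇒ (isCertified c) ok
  in 1<n , n∣N , 5<p , primitiveCheck-sound (isCertified-sound c c-ok) n∣N primitive-ok

table : Vec Row 173
table =
    row 3 2 (cert 7 1 [])
  ∷ row 11 3 (cert 23 1 [])
  ∷ row 5 1 (cert 31 1 [])
  ∷ row 35 29 (cert 71 1 [])
  ∷ row 9 7 (cert 73 1 [])
  ∷ row 39 10 (cert 79 1 [])
  ∷ row 11 7 (cert 89 1 [])
  ∷ row 7 5 (cert 127 1 [])
  ∷ row 15 12 (cert 151 1 [])
  ∷ row 99 67 (cert 199 1 [])
  ∷ row 135 112 (cert 271 1 [])
  ∷ row 21 0 (cert 337 1 [])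
  ∷ row 231 171 (cert 463 1 [])
  ∷ row 25 3 (cert 601 1 [])
  ∷ row 45 37 (cert 631 1 [])
  ∷ row 55 10 (cert 881 1 [])
  ∷ row 91 76 (cert 911 1 [])
  ∷ row 117 64 (cert 937 1 [])
  ∷ row 495 130 (cert 991 1 [])
  ∷ row 25 23 (cert 1801 1 [])
  ∷ row 975 583 (cert 1951 1 [])
  ∷ row 1155 1039 (cert 2311 1 [])
  ∷ row 55 35 (cert 3191 1 [])
  ∷ row 1755 409 (cert 3511 1 [])
  ∷ row 2079 165 (cert 4159 1 [])
  ∷ row 525 258 (cert 4201 1 [])
  ∷ row 2475 1299 (cert 4951 1 [])
  ∷ row 1001 437 (cert 6007 1 [])
  ∷ row 117 46 (cert 6553 1 [])
  ∷ row 325 308 (cert 7151 1 [])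
  ∷ row 525 364 (cert 7351 1 [])
  ∷ row 13 4 (cert 8191 1 [])
  ∷ row 1925 1130 (cert 11551 1 [])
  ∷ row 2079 732 (cert 16633 1 [])
  ∷ row 2925 544 (cert 17551 1 [])
  ∷ row 45 10 (cert 23311 1 [])
  ∷ row 105 24 (cert 29191 1 [])
  ∷ row 175 8 (cert 39551 1 [])
  ∷ row 385 20 (cert 55441 1 [])
  ∷ row 117 1 (cert 86113 1 [])
  ∷ row 63 18 (cert 92737 1 [])
  ∷ row 75 18 (cert 100801 1 [])
  ∷ row 17325 6936 (cert 103951 1 [])
  ∷ row 105 69 (cert 106681 1 [])
  ∷ row 225 163 (cert 115201 1 [])
  ∷ row 39 13 (cert 121369 1 [])
  ∷ row 35 9 (cert 122921 1 [])
  ∷ row 2475 769 (cert 143551 1 [])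
  ∷ row 75075 70915 (cert 150151 1 [])
  ∷ row 105 30 (cert 152041 1 [])
  ∷ row 99 22 (cert 153649 1 [])
  ∷ row 455 424 (cert 200201 1 [])
  ∷ row 55 5 (cert 201961 1 [])
  ∷ row 1287 382 (cert 216217 1 [])
  ∷ row 2275 854 (cert 218401 1 [])
  ∷ row 27 22 (cert 262657 1 [])
  ∷ row 6435 2793 (cert 270271 1 [])
  ∷ row 135 67 (cert 348031 1 [])
  ∷ row 351 220 (cert 446473 1 [])
  ∷ row 1365 139 (cert 469561 1 [])
  ∷ row 2457 1110 (cert 565111 1 [])
  ∷ row 33 15 (cert 599479 1 [])
  ∷ row 225 118 (cert 617401 1 [])
  ∷ row 63 60 (cert 649657 1 [])
  ∷ row 143 74 (cert 724153 1 [])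
  ∷ row 315 15 (cert 870031 1 [])
  ∷ row 315 225 (cert 983431 1 [])
  ∷ row 20475 13296 (cert 1187551 1 [])
  ∷ row 2457 1677 (cert 1410319 1 [])
  ∷ row 10725 908 (cert 1458601 1 [])
  ∷ row 189 102 (cert 1560007 1 [])
  ∷ row 675 489 (cert 1605151 1 [])
  ∷ row 1755 58 (cert 1969111 1 [])
  ∷ row 6435 5718 (cert 5057911 1 [])
  ∷ row 3465 984 (cert 7983361 1 [])
  ∷ row 297 4 (cert 8950393 1 [])
  ∷ row 27027 5377 (cert 9945937 5 (cert 2 1 [] ∷ cert 2 1 [] ∷ cert 2 1 [] ∷ cert 2 1 [] ∷ cert 3 1 [] ∷ cert 3 1 [] ∷ cert 3 1 [] ∷ cert 7 1 [] ∷ cert 11 1 [] ∷ cert 13 1 [] ∷ cert 23 1 [] ∷ []))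
  ∷ row 75 63 (cert 10567201 11 (cert 2 1 [] ∷ cert 2 1 [] ∷ cert 2 1 [] ∷ cert 2 1 [] ∷ cert 2 1 [] ∷ cert 3 1 [] ∷ cert 5 1 [] ∷ cert 5 1 [] ∷ cert 7 1 [] ∷ cert 17 1 [] ∷ cert 37 1 [] ∷ []))
  ∷ row 1925 580 (cert 13167001 23 (cert 2 1 [] ∷ cert 2 1 [] ∷ cert 2 1 [] ∷ cert 3 1 [] ∷ cert 3 1 [] ∷ cert 5 1 [] ∷ cert 5 1 [] ∷ cert 5 1 [] ∷ cert 7 1 [] ∷ cert 11 1 [] ∷ cert 19 1 [] ∷ []))
  ∷ row 45045 12593 (cert 15135121 23 (cert 2 1 [] ∷ cert 2 1 [] ∷ cert 2 1 [] ∷ cert 2 1 [] ∷ cert 3 1 [] ∷ cert 3 1 [] ∷ cert 3 1 [] ∷ cert 5 1 [] ∷ cert 7 1 [] ∷ cert 7 1 [] ∷ cert 11 1 [] ∷ cert 13 1 [] ∷ []))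
  ∷ row 1485 1164 (cert 19694071 6 (cert 2 1 [] ∷ cert 3 1 [] ∷ cert 3 1 [] ∷ cert 3 1 [] ∷ cert 5 1 [] ∷ cert 11 1 [] ∷ cert 19 1 [] ∷ cert 349 1 [] ∷ []))
  ∷ row 2457 2055 (cert 21287449 33 (cert 2 1 [] ∷ cert 2 1 [] ∷ cert 2 1 [] ∷ cert 3 1 [] ∷ cert 3 1 [] ∷ cert 3 1 [] ∷ cert 3 1 [] ∷ cert 7 1 [] ∷ cert 13 1 [] ∷ cert 19 1 [] ∷ cert 19 1 [] ∷ []))
  ∷ row 96525 71678 (cert 22972951 6 (cert 2 1 [] ∷ cert 3 1 [] ∷ cert 3 1 [] ∷ cert 3 1 [] ∷ cert 5 1 [] ∷ cert 5 1 [] ∷ cert 7 1 [] ∷ cert 11 1 [] ∷ cert 13 1 [] ∷ cert 17 1 [] ∷ []))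
  ∷ row 351 175 (cert 29121769 11 (cert 2 1 [] ∷ cert 2 1 [] ∷ cert 2 1 [] ∷ cert 3 1 [] ∷ cert 3 1 [] ∷ cert 3 1 [] ∷ cert 3 1 [] ∷ cert 13 1 [] ∷ cert 3457 1 [] ∷ []))
  ∷ row 4095 3063 (cert 40466791 6 (cert 2 1 [] ∷ cert 3 1 [] ∷ cert 3 1 [] ∷ cert 3 1 [] ∷ cert 3 1 [] ∷ cert 3 1 [] ∷ cert 3 1 [] ∷ cert 5 1 [] ∷ cert 7 1 [] ∷ cert 13 1 [] ∷ cert 61 1 [] ∷ []))
  ∷ row 2457 543 (cert 41194063 3 (cert 2 1 [] ∷ cert 3 1 [] ∷ cert 3 1 [] ∷ cert 3 1 [] ∷ cert 7 1 [] ∷ cert 13 1 [] ∷ cert 83 1 [] ∷ cert 101 1 [] ∷ []))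
  ∷ row 175 58 (cert 60816001 29 (cert 2 1 [] ∷ cert 2 1 [] ∷ cert 2 1 [] ∷ cert 2 1 [] ∷ cert 2 1 [] ∷ cert 2 1 [] ∷ cert 2 1 [] ∷ cert 3 1 [] ∷ cert 5 1 [] ∷ cert 5 1 [] ∷ cert 5 1 [] ∷ cert 7 1 [] ∷ cert 181 1 [] ∷ []))
  ∷ row 1287 1003 (cert 71477407 6 (cert 2 1 [] ∷ cert 3 1 [] ∷ cert 3 1 [] ∷ cert 7 1 [] ∷ cert 11 1 [] ∷ cert 13 1 [] ∷ cert 3967 1 [] ∷ []))
  ∷ row 1575 669 (cert 82013401 22 (cert 2 1 [] ∷ cert 2 1 [] ∷ cert 2 1 [] ∷ cert 3 1 [] ∷ cert 3 1 [] ∷ cert 5 1 [] ∷ cert 5 1 [] ∷ cert 7 1 [] ∷ cert 23 1 [] ∷ cert 283 1 [] ∷ []))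
  ∷ row 12285 7380 (cert 84299671 6 (cert 2 1 [] ∷ cert 3 1 [] ∷ cert 3 1 [] ∷ cert 3 1 [] ∷ cert 5 1 [] ∷ cert 7 1 [] ∷ cert 13 1 [] ∷ cert 47 1 [] ∷ cert 73 1 [] ∷ []))
  ∷ row 273 70 (cert 108749551 6 (cert 2 1 [] ∷ cert 3 1 [] ∷ cert 5 1 [] ∷ cert 5 1 [] ∷ cert 7 1 [] ∷ cert 13 1 [] ∷ cert 31 1 [] ∷ cert 257 1 [] ∷ []))
  ∷ row 91 83 (cert 112901153 3 (cert 2 1 [] ∷ cert 2 1 [] ∷ cert 2 1 [] ∷ cert 2 1 [] ∷ cert 2 1 [] ∷ cert 7 1 [] ∷ cert 13 1 [] ∷ cert 137 1 [] ∷ cert 283 1 [] ∷ []))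
  ∷ row 19305 3702 (cert 138841561 28 (cert 2 1 [] ∷ cert 2 1 [] ∷ cert 2 1 [] ∷ cert 3 1 [] ∷ cert 3 1 [] ∷ cert 3 1 [] ∷ cert 5 1 [] ∷ cert 11 1 [] ∷ cert 13 1 [] ∷ cert 29 1 [] ∷ cert 31 1 [] ∷ []))
  ∷ row 61425 35699 (cert 172481401 53 (cert 2 1 [] ∷ cert 2 1 [] ∷ cert 2 1 [] ∷ cert 3 1 [] ∷ cert 3 1 [] ∷ cert 3 1 [] ∷ cert 3 1 [] ∷ cert 3 1 [] ∷ cert 3 1 [] ∷ cert 5 1 [] ∷ cert 5 1 [] ∷ cert 7 1 [] ∷ cert 13 1 [] ∷ cert 13 1 [] ∷ []))
  ∷ row 525 49 (cert 181165951 3 (cert 2 1 [] ∷ cert 3 1 [] ∷ cert 3 1 [] ∷ cert 3 1 [] ∷ cert 5 1 [] ∷ cert 5 1 [] ∷ cert 7 1 [] ∷ cert 19 1 [] ∷ cert 1009 1 [] ∷ []))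
  ∷ row 693 435 (cert 289511839 3 (cert 2 1 [] ∷ cert 3 1 [] ∷ cert 3 1 [] ∷ cert 7 1 [] ∷ cert 11 1 [] ∷ cert 89 1 [] ∷ cert 2347 1 [] ∷ []))
  ∷ row 9009 6778 (cert 345206863 3 (cert 2 1 [] ∷ cert 3 1 [] ∷ cert 3 1 [] ∷ cert 7 1 [] ∷ cert 7 1 [] ∷ cert 7 1 [] ∷ cert 11 1 [] ∷ cert 13 1 [] ∷ cert 17 1 [] ∷ cert 23 1 [] ∷ []))
  ∷ row 225 13 (cert 1348206751 3 (cert 2 1 [] ∷ cert 3 1 [] ∷ cert 3 1 [] ∷ cert 5 1 [] ∷ cert 5 1 [] ∷ cert 5 1 [] ∷ cert 11 1 [] ∷ cert 19 1 [] ∷ cert 47 1 [] ∷ cert 61 1 [] ∷ []))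
  ∷ row 1925 855 (cert 1891705201 19 (cert 2 1 [] ∷ cert 2 1 [] ∷ cert 2 1 [] ∷ cert 2 1 [] ∷ cert 3 1 [] ∷ cert 5 1 [] ∷ cert 5 1 [] ∷ cert 7 1 [] ∷ cert 11 1 [] ∷ cert 59 1 [] ∷ cert 347 1 [] ∷ []))
  ∷ row 10725 4458 (cert 1965763801 19 (cert 2 1 [] ∷ cert 2 1 [] ∷ cert 2 1 [] ∷ cert 3 1 [] ∷ cert 3 1 [] ∷ cert 5 1 [] ∷ cert 5 1 [] ∷ cert 7 1 [] ∷ cert 11 1 [] ∷ cert 13 1 [] ∷ cert 1091 1 [] ∷ []))
  ∷ row 585 379 (cert 2400314671 3 (cert 2 1 [] ∷ cert 3 1 [] ∷ cert 3 1 [] ∷ cert 5 1 [] ∷ cert 13 1 [] ∷ cert 79 1 [] ∷ cert 25969 1 [] ∷ []))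
  ∷ row 20475 9649 (cert 3678661351 12 (cert 2 1 [] ∷ cert 3 1 [] ∷ cert 3 1 [] ∷ cert 5 1 [] ∷ cert 5 1 [] ∷ cert 7 1 [] ∷ cert 13 1 [] ∷ cert 89833 1 [] ∷ []))
  ∷ row 1155 934 (cert 6250631311 3 (cert 2 1 [] ∷ cert 3 1 [] ∷ cert 3 1 [] ∷ cert 5 1 [] ∷ cert 7 1 [] ∷ cert 11 1 [] ∷ cert 11 1 [] ∷ cert 167 1 [] ∷ cert 491 1 [] ∷ []))
  ∷ row 117 19 (cert 7830118297 5 (cert 2 1 [] ∷ cert 2 1 [] ∷ cert 2 1 [] ∷ cert 3 1 [] ∷ cert 3 1 [] ∷ cert 7 1 [] ∷ cert 11 1 [] ∷ cert 13 1 [] ∷ cert 108643 1 [] ∷ []))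
  ∷ row 4725 4134 (cert 7944010201 17 (cert 2 1 [] ∷ cert 2 1 [] ∷ cert 2 1 [] ∷ cert 3 1 [] ∷ cert 3 1 [] ∷ cert 3 1 [] ∷ cert 3 1 [] ∷ cert 3 1 [] ∷ cert 5 1 [] ∷ cert 5 1 [] ∷ cert 7 1 [] ∷ cert 19 1 [] ∷ cert 1229 1 [] ∷ []))
  ∷ row 45045 10076 (cert 9297558271 7 (cert 2 1 [] ∷ cert 3 1 [] ∷ cert 3 1 [] ∷ cert 3 1 [] ∷ cert 3 1 [] ∷ cert 5 1 [] ∷ cert 7 1 [] ∷ cert 11 1 [] ∷ cert 13 1 [] ∷ cert 11467 1 [] ∷ []))
  ∷ row 429 262 (cert 17286204937 5 (cert 2 1 [] ∷ cert 2 1 [] ∷ cert 2 1 [] ∷ cert 3 1 [] ∷ cert 7 1 [] ∷ cert 11 1 [] ∷ cert 13 1 [] ∷ cert 37 1 [] ∷ cert 19447 1 [] ∷ []))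
  ∷ row 91 34 (cert 23140471537 43 (cert 2 1 [] ∷ cert 2 1 [] ∷ cert 2 1 [] ∷ cert 2 1 [] ∷ cert 3 1 [] ∷ cert 3 1 [] ∷ cert 7 1 [] ∷ cert 13 1 [] ∷ cert 17 1 [] ∷ cert 109 1 [] ∷ cert 953 1 [] ∷ []))
  ∷ row 2275 154 (cert 28319200001 3 (cert 2 1 [] ∷ cert 2 1 [] ∷ cert 2 1 [] ∷ cert 2 1 [] ∷ cert 2 1 [] ∷ cert 2 1 [] ∷ cert 2 1 [] ∷ cert 2 1 [] ∷ cert 5 1 [] ∷ cert 5 1 [] ∷ cert 5 1 [] ∷ cert 5 1 [] ∷ cert 5 1 [] ∷ cert 7 1 [] ∷ cert 13 1 [] ∷ cert 389 1 [] ∷ []))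
  ∷ row 1575 354 (cert 32758188751 14 (cert 2 1 [] ∷ cert 3 1 [] ∷ cert 3 1 [] ∷ cert 3 1 [] ∷ cert 5 1 [] ∷ cert 5 1 [] ∷ cert 5 1 [] ∷ cert 5 1 [] ∷ cert 7 1 [] ∷ cert 313 1 [] ∷ cert 443 1 [] ∷ []))
  ∷ row 99 94 (cert 33057806959 3 (cert 2 1 [] ∷ cert 3 1 [] ∷ cert 3 1 [] ∷ cert 11 1 [] ∷ cert 757 1 [] ∷ cert 220553 1 [] ∷ []))
  ∷ row 325 158 (cert 51879585551 23 (cert 2 1 [] ∷ cert 5 1 [] ∷ cert 5 1 [] ∷ cert 13 1 [] ∷ cert 197 1 [] ∷ cert 379 1 [] ∷ cert 1069 1 [] ∷ []))
  ∷ row 2079 354 (cert 80932047967 3 (cert 2 1 [] ∷ cert 3 1 [] ∷ cert 3 1 [] ∷ cert 3 1 [] ∷ cert 3 1 [] ∷ cert 7 1 [] ∷ cert 11 1 [] ∷ cert 709 1 [] ∷ cert 9151 1 [] ∷ []))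
  ∷ row 2145 769 (cert 96001053721 7 (cert 2 1 [] ∷ cert 2 1 [] ∷ cert 2 1 [] ∷ cert 3 1 [] ∷ cert 5 1 [] ∷ cert 11 1 [] ∷ cert 13 1 [] ∷ cert 5594467 1 [] ∷ []))
  ∷ row 3575 8 (cert 124326802601 3 (cert 2 1 [] ∷ cert 2 1 [] ∷ cert 2 1 [] ∷ cert 5 1 [] ∷ cert 5 1 [] ∷ cert 7 1 [] ∷ cert 11 1 [] ∷ cert 13 1 [] ∷ cert 621013 1 [] ∷ []))
  ∷ row 143 41 (cert 158822951431 11 (cert 2 1 [] ∷ cert 3 1 [] ∷ cert 5 1 [] ∷ cert 11 1 [] ∷ cert 13 1 [] ∷ cert 43 1 [] ∷ cert 860969 1 [] ∷ []))
  ∷ row 27027 8954 (cert 377304487561 46 (cert 2 1 [] ∷ cert 2 1 [] ∷ cert 2 1 [] ∷ cert 3 1 [] ∷ cert 3 1 [] ∷ cert 3 1 [] ∷ cert 5 1 [] ∷ cert 7 1 [] ∷ cert 11 1 [] ∷ cert 13 1 [] ∷ cert 349007 1 [] ∷ []))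
  ∷ row 1155 409 (cert 494224324441 41 (cert 2 1 [] ∷ cert 2 1 [] ∷ cert 2 1 [] ∷ cert 3 1 [] ∷ cert 5 1 [] ∷ cert 7 1 [] ∷ cert 11 1 [] ∷ cert 107 1 [] ∷ cert 499883 1 [] ∷ []))
  ∷ row 8775 5133 (cert 802200601801 29 (cert 2 1 [] ∷ cert 2 1 [] ∷ cert 2 1 [] ∷ cert 3 1 [] ∷ cert 3 1 [] ∷ cert 3 1 [] ∷ cert 5 1 [] ∷ cert 5 1 [] ∷ cert 13 1 [] ∷ cert 619 1 [] ∷ cert 18461 1 [] ∷ []))
  ∷ row 2475 1209 (cert 1086033846151 6 (cert 2 1 [] ∷ cert 3 1 [] ∷ cert 3 1 [] ∷ cert 5 1 [] ∷ cert 5 1 [] ∷ cert 11 1 [] ∷ cert 6949 1 [] ∷ cert 31573 1 [] ∷ []))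
  ∷ row 2925 1894 (cert 1432354107601 31 (cert 2 1 [] ∷ cert 2 1 [] ∷ cert 2 1 [] ∷ cert 2 1 [] ∷ cert 3 1 [] ∷ cert 3 1 [] ∷ cert 5 1 [] ∷ cert 5 1 [] ∷ cert 13 1 [] ∷ cert 53 1 [] ∷ cert 127 1 [] ∷ cert 4547 1 [] ∷ []))
  ∷ row 2925 1533 (cert 1815785752951 3 (cert 2 1 [] ∷ cert 3 1 [] ∷ cert 3 1 [] ∷ cert 5 1 [] ∷ cert 5 1 [] ∷ cert 13 1 [] ∷ cert 23 1 [] ∷ cert 43 1 [] ∷ cert 157 1 [] ∷ cert 1999 1 [] ∷ []))
  ∷ row 385 160 (cert 1971764055031 7 (cert 2 1 [] ∷ cert 3 1 [] ∷ cert 5 1 [] ∷ cert 7 1 [] ∷ cert 11 1 [] ∷ cert 15601 1 [] ∷ cert 54713 1 [] ∷ []))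
  ∷ row 10395 4793 (cert 11152573899391 6 (cert 2 1 [] ∷ cert 3 1 [] ∷ cert 3 1 [] ∷ cert 3 1 [] ∷ cert 5 1 [] ∷ cert 7 1 [] ∷ cert 11 1 [] ∷ cert 47 1 [] ∷ cert 53 1 [] ∷ cert 215351 1 [] ∷ []))
  ∷ row 3465 1614 (cert 25163432882281 13 (cert 2 1 [] ∷ cert 2 1 [] ∷ cert 2 1 [] ∷ cert 3 1 [] ∷ cert 3 1 [] ∷ cert 3 1 [] ∷ cert 5 1 [] ∷ cert 7 1 [] ∷ cert 11 1 [] ∷ cert 302590583 5 (cert 2 1 [] ∷ cert 7 1 [] ∷ cert 7 1 [] ∷ cert 17 1 [] ∷ cert 29 1 [] ∷ cert 6263 1 [] ∷ []) ∷ []))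
  ∷ row 135 30 (cert 49971617830801 11 (cert 2 1 [] ∷ cert 2 1 [] ∷ cert 2 1 [] ∷ cert 2 1 [] ∷ cert 3 1 [] ∷ cert 3 1 [] ∷ cert 3 1 [] ∷ cert 5 1 [] ∷ cert 5 1 [] ∷ cert 45317 1 [] ∷ cert 102103 1 [] ∷ []))
  ∷ row 65 3 (cert 145295143558111 7 (cert 2 1 [] ∷ cert 3 1 [] ∷ cert 3 1 [] ∷ cert 5 1 [] ∷ cert 7 1 [] ∷ cert 7 1 [] ∷ cert 13 1 [] ∷ cert 2534364967 3 (cert 2 1 [] ∷ cert 3 1 [] ∷ cert 7 1 [] ∷ cert 7 1 [] ∷ cert 8620289 1 [] ∷ []) ∷ []))
  ∷ row 2145 580 (cert 347878768688881 14 (cert 2 1 [] ∷ cert 2 1 [] ∷ cert 2 1 [] ∷ cert 2 1 [] ∷ cert 3 1 [] ∷ cert 5 1 [] ∷ cert 11 1 [] ∷ cert 13 1 [] ∷ cert 857 1 [] ∷ cert 11827687 5 (cert 2 1 [] ∷ cert 3 1 [] ∷ cert 13 1 [] ∷ cert 151637 1 [] ∷ []) ∷ []))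
  ∷ row 351 274 (cert 571890896913727 5 (cert 2 1 [] ∷ cert 3 1 [] ∷ cert 3 1 [] ∷ cert 3 1 [] ∷ cert 13 1 [] ∷ cert 37 1 [] ∷ cert 439 1 [] ∷ cert 1093 1 [] ∷ cert 45887 1 [] ∷ []))
  ∷ row 825 690 (cert 702948566745151 3 (cert 2 1 [] ∷ cert 3 1 [] ∷ cert 5 1 [] ∷ cert 5 1 [] ∷ cert 11 1 [] ∷ cert 11 1 [] ∷ cert 10979 1 [] ∷ cert 3527639 1 [] ∷ []))
  ∷ row 12285 8672 (cert 1421018719127281 29 (cert 2 1 [] ∷ cert 2 1 [] ∷ cert 2 1 [] ∷ cert 2 1 [] ∷ cert 3 1 [] ∷ cert 3 1 [] ∷ cert 3 1 [] ∷ cert 3 1 [] ∷ cert 3 1 [] ∷ cert 5 1 [] ∷ cert 7 1 [] ∷ cert 13 1 [] ∷ cert 67 1 [] ∷ cert 11989121 6 (cert 2 1 [] ∷ cert 2 1 [] ∷ cert 2 1 [] ∷ cert 2 1 [] ∷ cert 2 1 [] ∷ cert 2 1 [] ∷ cert 2 1 [] ∷ cert 5 1 [] ∷ cert 11 1 [] ∷ cert 13 1 [] ∷ cert 131 1 [] ∷ []) ∷ []))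
  ∷ row 819 193 (cert 2681001528674743 5 (cert 2 1 [] ∷ cert 3 1 [] ∷ cert 3 1 [] ∷ cert 7 1 [] ∷ cert 13 1 [] ∷ cert 631 1 [] ∷ cert 1637 1 [] ∷ cert 1584547 1 [] ∷ []))
  ∷ row 693 372 (cert 2868251407519807 10 (cert 2 1 [] ∷ cert 3 1 [] ∷ cert 3 1 [] ∷ cert 7 1 [] ∷ cert 11 1 [] ∷ cert 151 1 [] ∷ cert 151 1 [] ∷ cert 163 1 [] ∷ cert 556817 1 [] ∷ []))
  ∷ row 273 112 (cert 4093204977277417 19 (cert 2 1 [] ∷ cert 2 1 [] ∷ cert 2 1 [] ∷ cert 3 1 [] ∷ cert 3 1 [] ∷ cert 3 1 [] ∷ cert 7 1 [] ∷ cert 11 1 [] ∷ cert 13 1 [] ∷ cert 107 1 [] ∷ cert 176926093 2 (cert 2 1 [] ∷ cert 2 1 [] ∷ cert 3 1 [] ∷ cert 7 1 [] ∷ cert 421 1 [] ∷ cert 5003 1 [] ∷ []) ∷ []))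
  ∷ row 1925 1649 (cert 5591298184498951 3 (cert 2 1 [] ∷ cert 3 1 [] ∷ cert 5 1 [] ∷ cert 5 1 [] ∷ cert 7 1 [] ∷ cert 11 1 [] ∷ cert 11 1 [] ∷ cert 8219 1 [] ∷ cert 5354501 1 [] ∷ []))
  ∷ row 975 658 (cert 8837728285481551 3 (cert 2 1 [] ∷ cert 3 1 [] ∷ cert 3 1 [] ∷ cert 3 1 [] ∷ cert 5 1 [] ∷ cert 5 1 [] ∷ cert 7 1 [] ∷ cert 13 1 [] ∷ cert 13 1 [] ∷ cert 5533783091 6 (cert 2 1 [] ∷ cert 5 1 [] ∷ cert 11 1 [] ∷ cert 43 1 [] ∷ cert 1169933 1 [] ∷ []) ∷ []))
  ∷ row 825 195 (cert 9115784422509601 13 (cert 2 1 [] ∷ cert 2 1 [] ∷ cert 2 1 [] ∷ cert 2 1 [] ∷ cert 2 1 [] ∷ cert 3 1 [] ∷ cert 3 1 [] ∷ cert 5 1 [] ∷ cert 5 1 [] ∷ cert 11 1 [] ∷ cert 17 1 [] ∷ cert 61 1 [] ∷ cert 110991599 11 (cert 2 1 [] ∷ cert 193 1 [] ∷ cert 421 1 [] ∷ cert 683 1 [] ∷ []) ∷ []))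
  ∷ row 225 193 (cert 13861369826299351 3 (cert 2 1 [] ∷ cert 3 1 [] ∷ cert 3 1 [] ∷ cert 5 1 [] ∷ cert 5 1 [] ∷ cert 41 1 [] ∷ cert 1933 1 [] ∷ cert 388667231 14 (cert 2 1 [] ∷ cert 5 1 [] ∷ cert 7 1 [] ∷ cert 19 1 [] ∷ cert 292231 1 [] ∷ []) ∷ []))
  ∷ row 351 40 (cert 93715008807883087 3 (cert 2 1 [] ∷ cert 3 1 [] ∷ cert 3 1 [] ∷ cert 3 1 [] ∷ cert 13 1 [] ∷ cert 83 1 [] ∷ cert 1608399560771 2 (cert 2 1 [] ∷ cert 5 1 [] ∷ cert 349 1 [] ∷ cert 460859473 10 (cert 2 1 [] ∷ cert 2 1 [] ∷ cert 2 1 [] ∷ cert 2 1 [] ∷ cert 3 1 [] ∷ cert 3 1 [] ∷ cert 3200413 1 [] ∷ []) ∷ []) ∷ []))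
  ∷ row 3003 2832 (cert 186455718778046719 3 (cert 2 1 [] ∷ cert 3 1 [] ∷ cert 7 1 [] ∷ cert 7 1 [] ∷ cert 11 1 [] ∷ cert 13 1 [] ∷ cert 2161 1 [] ∷ cert 7027 1 [] ∷ cert 292057 1 [] ∷ []))
  ∷ row 715 250 (cert 249602191565465311 37 (cert 2 1 [] ∷ cert 3 1 [] ∷ cert 5 1 [] ∷ cert 11 1 [] ∷ cert 13 1 [] ∷ cert 58182329036239 3 (cert 2 1 [] ∷ cert 3 1 [] ∷ cert 11 1 [] ∷ cert 1709 1 [] ∷ cert 515828227 2 (cert 2 1 [] ∷ cert 3 1 [] ∷ cert 19 1 [] ∷ cert 733 1 [] ∷ cert 6173 1 [] ∷ []) ∷ []) ∷ []))
  ∷ row 1925 0 (cert 292615400703113951 13 (cert 2 1 [] ∷ cert 5 1 [] ∷ cert 5 1 [] ∷ cert 7 1 [] ∷ cert 11 1 [] ∷ cert 11 1 [] ∷ cert 1120741 1 [] ∷ cert 6165077 1 [] ∷ []))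
  ∷ row 585 154 (cert 339175003117573351 7 (cert 2 1 [] ∷ cert 3 1 [] ∷ cert 3 1 [] ∷ cert 5 1 [] ∷ cert 5 1 [] ∷ cert 7 1 [] ∷ cert 7 1 [] ∷ cert 13 1 [] ∷ cert 23 1 [] ∷ cert 131 1 [] ∷ cert 139 1 [] ∷ cert 1013 1 [] ∷ cert 2789 1 [] ∷ []))
  ∷ row 77 31 (cert 581283643249112959 6 (cert 2 1 [] ∷ cert 3 1 [] ∷ cert 3 1 [] ∷ cert 7 1 [] ∷ cert 11 1 [] ∷ cert 31 1 [] ∷ cert 13528921548413 2 (cert 2 1 [] ∷ cert 2 1 [] ∷ cert 19 1 [] ∷ cert 73 1 [] ∷ cert 1861 1 [] ∷ cert 1310329 1 [] ∷ []) ∷ []))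
  ∷ row 715 85 (cert 598887853030285391 11 (cert 2 1 [] ∷ cert 5 1 [] ∷ cert 11 1 [] ∷ cert 13 1 [] ∷ cert 1259 1 [] ∷ cert 332647096447 3 (cert 2 1 [] ∷ cert 3 1 [] ∷ cert 3 1 [] ∷ cert 7 1 [] ∷ cert 7 1 [] ∷ cert 1319 1 [] ∷ cert 285937 1 [] ∷ []) ∷ []))
  ∷ row 143 63 (cert 5782172113400990737 5 (cert 2 1 [] ∷ cert 2 1 [] ∷ cert 2 1 [] ∷ cert 2 1 [] ∷ cert 3 1 [] ∷ cert 11 1 [] ∷ cert 13 1 [] ∷ cert 53 1 [] ∷ cert 15894170606833 11 (cert 2 1 [] ∷ cert 2 1 [] ∷ cert 2 1 [] ∷ cert 2 1 [] ∷ cert 3 1 [] ∷ cert 7 1 [] ∷ cert 547 1 [] ∷ cert 1549 1 [] ∷ cert 55829 1 [] ∷ []) ∷ []))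
  ∷ row 2457 1488 (cert 16751168775662428927 3 (cert 2 1 [] ∷ cert 3 1 [] ∷ cert 3 1 [] ∷ cert 3 1 [] ∷ cert 7 1 [] ∷ cert 13 1 [] ∷ cert 3408866254713559 3 (cert 2 1 [] ∷ cert 3 1 [] ∷ cert 29 1 [] ∷ cert 29 1 [] ∷ cert 1667 1 [] ∷ cert 405253819 2 (cert 2 1 [] ∷ cert 3 1 [] ∷ cert 3 1 [] ∷ cert 22514101 2 (cert 2 1 [] ∷ cert 2 1 [] ∷ cert 3 1 [] ∷ cert 5 1 [] ∷ cert 5 1 [] ∷ cert 7 1 [] ∷ cert 71 1 [] ∷ cert 151 1 [] ∷ []) ∷ []) ∷ []) ∷ []))
  ∷ row 1755 1164 (cert 85488365519409100951 3 (cert 2 1 [] ∷ cert 3 1 [] ∷ cert 3 1 [] ∷ cert 3 1 [] ∷ cert 3 1 [] ∷ cert 3 1 [] ∷ cert 3 1 [] ∷ cert 5 1 [] ∷ cert 5 1 [] ∷ cert 13 1 [] ∷ cert 757 1 [] ∷ cert 109321 1 [] ∷ cert 2180051 1 [] ∷ []))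
  ∷ row 273 109 (cert 86977595801949844993 5 (cert 2 1 [] ∷ cert 2 1 [] ∷ cert 2 1 [] ∷ cert 2 1 [] ∷ cert 2 1 [] ∷ cert 2 1 [] ∷ cert 2 1 [] ∷ cert 2 1 [] ∷ cert 2 1 [] ∷ cert 3 1 [] ∷ cert 7 1 [] ∷ cert 11 1 [] ∷ cert 13 1 [] ∷ cert 4889 1 [] ∷ cert 68611 1 [] ∷ cert 168643 1 [] ∷ []))
  ∷ row 1287 1237 (cert 141968533929529744009 14 (cert 2 1 [] ∷ cert 2 1 [] ∷ cert 2 1 [] ∷ cert 3 1 [] ∷ cert 3 1 [] ∷ cert 11 1 [] ∷ cert 13 1 [] ∷ cert 67 1 [] ∷ cert 431 1 [] ∷ cert 477497927299 3 (cert 2 1 [] ∷ cert 3 1 [] ∷ cert 7 1 [] ∷ cert 173 1 [] ∷ cert 65716753 5 (cert 2 1 [] ∷ cert 2 1 [] ∷ cert 2 1 [] ∷ cert 2 1 [] ∷ cert 3 1 [] ∷ cert 1369099 1 [] ∷ []) ∷ []) ∷ []))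
  ∷ row 351 337 (cert 150832426800173710177 10 (cert 2 1 [] ∷ cert 2 1 [] ∷ cert 2 1 [] ∷ cert 2 1 [] ∷ cert 2 1 [] ∷ cert 3 1 [] ∷ cert 3 1 [] ∷ cert 3 1 [] ∷ cert 3 1 [] ∷ cert 3 1 [] ∷ cert 13 1 [] ∷ cert 61 1 [] ∷ cert 24460497135457 5 (cert 2 1 [] ∷ cert 2 1 [] ∷ cert 2 1 [] ∷ cert 2 1 [] ∷ cert 2 1 [] ∷ cert 3 1 [] ∷ cert 29 1 [] ∷ cert 43 1 [] ∷ cert 773 1 [] ∷ cert 264331 1 [] ∷ []) ∷ []))
  ∷ row 585 334 (cert 255375215316698521591 3 (cert 2 1 [] ∷ cert 3 1 [] ∷ cert 3 1 [] ∷ cert 3 1 [] ∷ cert 5 1 [] ∷ cert 7 1 [] ∷ cert 13 1 [] ∷ cert 239 1 [] ∷ cert 43488626180633 3 (cert 2 1 [] ∷ cert 2 1 [] ∷ cert 2 1 [] ∷ cert 227 1 [] ∷ cert 27241 1 [] ∷ cert 879097 1 [] ∷ []) ∷ []))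
  ∷ row 275 85 (cert 382027665134363932751 11 (cert 2 1 [] ∷ cert 5 1 [] ∷ cert 5 1 [] ∷ cert 5 1 [] ∷ cert 11 1 [] ∷ cert 222483011 2 (cert 2 1 [] ∷ cert 5 1 [] ∷ cert 22248301 2 (cert 2 1 [] ∷ cert 2 1 [] ∷ cert 3 1 [] ∷ cert 5 1 [] ∷ cert 5 1 [] ∷ cert 74161 1 [] ∷ []) ∷ []) ∷ cert 624403411 3 (cert 2 1 [] ∷ cert 3 1 [] ∷ cert 5 1 [] ∷ cert 20813447 5 (cert 2 1 [] ∷ cert 10406723 2 (cert 2 1 [] ∷ cert 61 1 [] ∷ cert 197 1 [] ∷ cert 433 1 [] ∷ []) ∷ []) ∷ []) ∷ []))
  ∷ row 975 0 (cert 26155966684789722885001 11 (cert 2 1 [] ∷ cert 2 1 [] ∷ cert 2 1 [] ∷ cert 3 1 [] ∷ cert 5 1 [] ∷ cert 5 1 [] ∷ cert 5 1 [] ∷ cert 5 1 [] ∷ cert 13 1 [] ∷ cert 46103 1 [] ∷ cert 2909423735681 3 (cert 2 1 [] ∷ cert 2 1 [] ∷ cert 2 1 [] ∷ cert 2 1 [] ∷ cert 2 1 [] ∷ cert 2 1 [] ∷ cert 2 1 [] ∷ cert 5 1 [] ∷ cert 7 1 [] ∷ cert 11 1 [] ∷ cert 23 1 [] ∷ cert 2566897 1 [] ∷ []) ∷ []))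
  ∷ row 175 108 (cert 535347624791488552837151 7 (cert 2 1 [] ∷ cert 5 1 [] ∷ cert 5 1 [] ∷ cert 7 1 [] ∷ cert 97 1 [] ∷ cert 137 1 [] ∷ cert 331 1 [] ∷ cert 261389 1 [] ∷ cert 1330332599 7 (cert 2 1 [] ∷ cert 7 1 [] ∷ cert 6203 1 [] ∷ cert 15319 1 [] ∷ []) ∷ []))
  ∷ row 165 0 (cert 2048568835297380486760231 6 (cert 2 1 [] ∷ cert 3 1 [] ∷ cert 5 1 [] ∷ cert 11 1 [] ∷ cert 31 1 [] ∷ cert 29527 1 [] ∷ cert 6781965931002463 5 (cert 2 1 [] ∷ cert 3 1 [] ∷ cert 41 1 [] ∷ cert 491 1 [] ∷ cert 811 1 [] ∷ cert 69233797 5 (cert 2 1 [] ∷ cert 2 1 [] ∷ cert 3 1 [] ∷ cert 3 1 [] ∷ cert 19 1 [] ∷ cert 127 1 [] ∷ cert 797 1 [] ∷ []) ∷ []) ∷ []))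
  ∷ row 27027 0 (cert 46674518089385993803836841 29 (cert 2 1 [] ∷ cert 2 1 [] ∷ cert 2 1 [] ∷ cert 3 1 [] ∷ cert 3 1 [] ∷ cert 3 1 [] ∷ cert 3 1 [] ∷ cert 5 1 [] ∷ cert 7 1 [] ∷ cert 11 1 [] ∷ cert 13 1 [] ∷ cert 1031 1 [] ∷ cert 19037 1 [] ∷ cert 177943 1 [] ∷ cert 4120621 1 [] ∷ []))
  ∷ row 20475 12727 (cert 105075758538263866449096001 19 (cert 2 1 [] ∷ cert 2 1 [] ∷ cert 2 1 [] ∷ cert 2 1 [] ∷ cert 2 1 [] ∷ cert 2 1 [] ∷ cert 3 1 [] ∷ cert 3 1 [] ∷ cert 5 1 [] ∷ cert 5 1 [] ∷ cert 5 1 [] ∷ cert 7 1 [] ∷ cert 11 1 [] ∷ cert 13 1 [] ∷ cert 1193 1 [] ∷ cert 5107 1 [] ∷ cert 28513 1 [] ∷ cert 8392411 1 [] ∷ []))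
  ∷ row 189 39 (cert 207617485544258392970753527 5 (cert 2 1 [] ∷ cert 3 1 [] ∷ cert 3 1 [] ∷ cert 3 1 [] ∷ cert 7 1 [] ∷ cert 43 1 [] ∷ cert 109 1 [] ∷ cert 3449 1 [] ∷ cert 376889 1 [] ∷ cert 90150993481 7 (cert 2 1 [] ∷ cert 2 1 [] ∷ cert 2 1 [] ∷ cert 3 1 [] ∷ cert 5 1 [] ∷ cert 751258279 7 (cert 2 1 [] ∷ cert 3 1 [] ∷ cert 3 1 [] ∷ cert 31 1 [] ∷ cert 1346341 1 [] ∷ []) ∷ []) ∷ []))
  ∷ row 195 94 (cert 134304196845099262572814573351 29 (cert 2 1 [] ∷ cert 3 1 [] ∷ cert 3 1 [] ∷ cert 5 1 [] ∷ cert 5 1 [] ∷ cert 7 1 [] ∷ cert 11 1 [] ∷ cert 13 1 [] ∷ cert 298155615151735514647163 2 (cert 2 1 [] ∷ cert 13 1 [] ∷ cert 19 1 [] ∷ cert 86573 1 [] ∷ cert 6971617904258551 6 (cert 2 1 [] ∷ cert 3 1 [] ∷ cert 5 1 [] ∷ cert 5 1 [] ∷ cert 83 1 [] ∷ cert 559969309579 2 (cert 2 1 [] ∷ cert 3 1 [] ∷ cert 7 1 [] ∷ cert 379 1 [] ∷ cert 35178371 2 (cert 2 1 [] ∷ cert 5 1 [] ∷ cert 71 1 [] ∷ cert 49547 1 [] ∷ []) ∷ []) ∷ []) ∷ []) ∷ []))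
  ∷ row 495 0 (cert 334202934764737951438594746151 13 (cert 2 1 [] ∷ cert 3 1 [] ∷ cert 3 1 [] ∷ cert 5 1 [] ∷ cert 5 1 [] ∷ cert 11 1 [] ∷ cert 11 1 [] ∷ cert 31 1 [] ∷ cert 9601 1 [] ∷ cert 20622162829726240597 5 (cert 2 1 [] ∷ cert 2 1 [] ∷ cert 3 1 [] ∷ cert 3 1 [] ∷ cert 11 1 [] ∷ cert 17 1 [] ∷ cert 31 1 [] ∷ cert 59 1 [] ∷ cert 121171 1 [] ∷ cert 13822217 3 (cert 2 1 [] ∷ cert 2 1 [] ∷ cert 2 1 [] ∷ cert 1727777 1 [] ∷ []) ∷ []) ∷ []))
  ∷ row 315 199 (cert 29728307155963706810228435378401 23 (cert 2 1 [] ∷ cert 2 1 [] ∷ cert 2 1 [] ∷ cert 2 1 [] ∷ cert 2 1 [] ∷ cert 3 1 [] ∷ cert 3 1 [] ∷ cert 5 1 [] ∷ cert 5 1 [] ∷ cert 7 1 [] ∷ cert 19 1 [] ∷ cert 3361 1 [] ∷ cert 11329 1 [] ∷ cert 3163739 1 [] ∷ cert 257706459649 13 (cert 2 1 [] ∷ cert 2 1 [] ∷ cert 2 1 [] ∷ cert 2 1 [] ∷ cert 2 1 [] ∷ cert 2 1 [] ∷ cert 2 1 [] ∷ cert 2 1 [] ∷ cert 2 1 [] ∷ cert 3 1 [] ∷ cert 3 1 [] ∷ cert 11 1 [] ∷ cert 5084171 1 [] ∷ []) ∷ []))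
  ∷ row 231 45 (cert 4982397651178256151338302204762057 5 (cert 2 1 [] ∷ cert 2 1 [] ∷ cert 2 1 [] ∷ cert 3 1 [] ∷ cert 7 1 [] ∷ cert 11 1 [] ∷ cert 263 1 [] ∷ cert 10251340779834444700957776169 7 (cert 2 1 [] ∷ cert 2 1 [] ∷ cert 2 1 [] ∷ cert 3 1 [] ∷ cert 103 1 [] ∷ cert 809 1 [] ∷ cert 218083 1 [] ∷ cert 23505087377168227 2 (cert 2 1 [] ∷ cert 3 1 [] ∷ cert 3 1 [] ∷ cert 60661 1 [] ∷ cert 21526816037 2 (cert 2 1 [] ∷ cert 2 1 [] ∷ cert 11 1 [] ∷ cert 489245819 2 (cert 2 1 [] ∷ cert 59 1 [] ∷ cert 101 1 [] ∷ cert 41051 1 [] ∷ []) ∷ []) ∷ []) ∷ []) ∷ []))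
  ∷ row 585 319 (cert 2728334536034592865339299805712535332071 11 (cert 2 1 [] ∷ cert 3 1 [] ∷ cert 3 1 [] ∷ cert 3 1 [] ∷ cert 5 1 [] ∷ cert 13 1 [] ∷ cert 137 1 [] ∷ cert 269032061 3 (cert 2 1 [] ∷ cert 2 1 [] ∷ cert 5 1 [] ∷ cert 11 1 [] ∷ cert 157 1 [] ∷ cert 7789 1 [] ∷ []) ∷ cert 21089481292941109487543701 6 (cert 2 1 [] ∷ cert 2 1 [] ∷ cert 3 1 [] ∷ cert 3 1 [] ∷ cert 5 1 [] ∷ cert 5 1 [] ∷ cert 37 1 [] ∷ cert 633317756544778062689 3 (cert 2 1 [] ∷ cert 2 1 [] ∷ cert 2 1 [] ∷ cert 2 1 [] ∷ cert 2 1 [] ∷ cert 7 1 [] ∷ cert 2827311413146330637 2 (cert 2 1 [] ∷ cert 2 1 [] ∷ cert 29 1 [] ∷ cert 20186687 5 (cert 2 1 [] ∷ cert 13 1 [] ∷ cert 23 1 [] ∷ cert 33757 1 [] ∷ []) ∷ cert 1207398433 5 (cert 2 1 [] ∷ cert 2 1 [] ∷ cert 2 1 [] ∷ cert 2 1 [] ∷ cert 2 1 [] ∷ cert 3 1 [] ∷ cert 23 1 [] ∷ cert 241 1 [] ∷ cert 2269 1 [] ∷ []) ∷ []) ∷ []) ∷ []) ∷ []))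
  ∷ row 275 250 (cert 4074891477354886815033308087379995347151 7 (cert 2 1 [] ∷ cert 5 1 [] ∷ cert 5 1 [] ∷ cert 11 1 [] ∷ cert 19 1 [] ∷ cert 79 1 [] ∷ cert 39839 1 [] ∷ cert 773228936539 2 (cert 2 1 [] ∷ cert 3 1 [] ∷ cert 3 1 [] ∷ cert 42957163141 2 (cert 2 1 [] ∷ cert 2 1 [] ∷ cert 3 1 [] ∷ cert 5 1 [] ∷ cert 31 1 [] ∷ cert 1901 1 [] ∷ cert 12149 1 [] ∷ []) ∷ []) ∷ cert 160234540187544653 2 (cert 2 1 [] ∷ cert 2 1 [] ∷ cert 229 1 [] ∷ cert 2593 1 [] ∷ cert 67461834679 3 (cert 2 1 [] ∷ cert 3 1 [] ∷ cert 7 1 [] ∷ cert 1606234159 3 (cert 2 1 [] ∷ cert 3 1 [] ∷ cert 3 1 [] ∷ cert 3 1 [] ∷ cert 37 1 [] ∷ cert 803921 1 [] ∷ []) ∷ []) ∷ []) ∷ []))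
  ∷ row 495 0 (cert 6084777159537635796550536863741698483921 7 (cert 2 1 [] ∷ cert 2 1 [] ∷ cert 2 1 [] ∷ cert 2 1 [] ∷ cert 3 1 [] ∷ cert 3 1 [] ∷ cert 5 1 [] ∷ cert 11 1 [] ∷ cert 11 1 [] ∷ cert 23 1 [] ∷ cert 1721 1 [] ∷ cert 9377 1 [] ∷ cert 152441 1 [] ∷ cert 557303 1 [] ∷ cert 2214935168168137 5 (cert 2 1 [] ∷ cert 2 1 [] ∷ cert 2 1 [] ∷ cert 3 1 [] ∷ cert 19 1 [] ∷ cert 47977 1 [] ∷ cert 101242553 3 (cert 2 1 [] ∷ cert 2 1 [] ∷ cert 2 1 [] ∷ cert 857 1 [] ∷ cert 14767 1 [] ∷ []) ∷ []) ∷ []))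
  ∷ row 297 202 (cert 170886618823141738081830950807292771648313599433 5 (cert 2 1 [] ∷ cert 2 1 [] ∷ cert 2 1 [] ∷ cert 3 1 [] ∷ cert 3 1 [] ∷ cert 3 1 [] ∷ cert 3 1 [] ∷ cert 3 1 [] ∷ cert 11 1 [] ∷ cert 24169 1 [] ∷ cert 330643834936247066639951011671532197217 5 (cert 2 1 [] ∷ cert 2 1 [] ∷ cert 2 1 [] ∷ cert 2 1 [] ∷ cert 2 1 [] ∷ cert 3 1 [] ∷ cert 3 1 [] ∷ cert 47 1 [] ∷ cert 613 1 [] ∷ cert 195942793 10 (cert 2 1 [] ∷ cert 2 1 [] ∷ cert 2 1 [] ∷ cert 3 1 [] ∷ cert 29 1 [] ∷ cert 281527 1 [] ∷ []) ∷ cert 203366921720565351454609 13 (cert 2 1 [] ∷ cert 2 1 [] ∷ cert 2 1 [] ∷ cert 2 1 [] ∷ cert 3 1 [] ∷ cert 7 1 [] ∷ cert 605258695596920688853 2 (cert 2 1 [] ∷ cert 2 1 [] ∷ cert 3 1 [] ∷ cert 23 1 [] ∷ cert 4729 1 [] ∷ cert 463727276040313 5 (cert 2 1 [] ∷ cert 2 1 [] ∷ cert 2 1 [] ∷ cert 3 1 [] ∷ cert 3 1 [] ∷ cert 29 1 [] ∷ cert 241 1 [] ∷ cert 921541939 2 (cert 2 1 [] ∷ cert 3 1 [] ∷ cert 153590323 2 (cert 2 1 [] ∷ cert 3 1 [] ∷ cert 29 1 [] ∷ cert 882703 1 [] ∷ []) ∷ []) ∷ []) ∷ []) ∷ [])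 ∷ []) ∷ []))
  ∷ row 385 265 (cert 31055341681190444478126719755965134571151473925765532041 17 (cert 2 1 [] ∷ cert 2 1 [] ∷ cert 2 1 [] ∷ cert 3 1 [] ∷ cert 5 1 [] ∷ cert 7 1 [] ∷ cert 11 1 [] ∷ cert 95801 1 [] ∷ cert 8550317731777 10 (cert 2 1 [] ∷ cert 2 1 [] ∷ cert 2 1 [] ∷ cert 2 1 [] ∷ cert 2 1 [] ∷ cert 2 1 [] ∷ cert 3 1 [] ∷ cert 1129 1 [] ∷ cert 39444557 2 (cert 2 1 [] ∷ cert 2 1 [] ∷ cert 17 1 [] ∷ cert 191 1 [] ∷ cert 3037 1 [] ∷ []) ∷ []) ∷ cert 4103099462305089818203365940179923 5 (cert 2 1 [] ∷ cert 13 1 [] ∷ cert 19 1 [] ∷ cert 1294668122819 6 (cert 2 1 [] ∷ cert 7 1 [] ∷ cert 92476294487 5 (cert 2 1 [] ∷ cert 19 1 [] ∷ cert 2433586697 3 (cert 2 1 [] ∷ cert 2 1 [] ∷ cert 2 1 [] ∷ cert 304198337 3 (cert 2 1 [] ∷ cert 2 1 [] ∷ cert 2 1 [] ∷ cert 2 1 [] ∷ cert 2 1 [] ∷ cert 2 1 [] ∷ cert 13 1 [] ∷ cert 59 1 [] ∷ cert 6197 1 [] ∷ []) ∷ []) ∷ []) ∷ []) ∷ cert 6415442854040277877 2 (cert 2 1 [] ∷ cert 2 1 [] ∷ cert 3 1 [] ∷ cert 7 1 [] ∷ cert 13 1 [] ∷ cert 23 1 [] ∷ cert 23 1 [] ∷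 cert 1929527 1 [] ∷ cert 5755691 1 [] ∷ []) ∷ []) ∷ []))
  ∷ row 525 259 (cert 325985508875527587669607097222667557116221139090131514801 31 (cert 2 1 [] ∷ cert 2 1 [] ∷ cert 2 1 [] ∷ cert 2 1 [] ∷ cert 3 1 [] ∷ cert 5 1 [] ∷ cert 5 1 [] ∷ cert 7 1 [] ∷ cert 17 1 [] ∷ cert 3229 1 [] ∷ cert 123404371 2 (cert 2 1 [] ∷ cert 3 1 [] ∷ cert 5 1 [] ∷ cert 97 1 [] ∷ cert 42407 1 [] ∷ []) ∷ cert 3794400427 2 (cert 2 1 [] ∷ cert 3 1 [] ∷ cert 29 1 [] ∷ cert 757 1 [] ∷ cert 28807 1 [] ∷ []) ∷ cert 1509831003005189181909647676787 3 (cert 2 1 [] ∷ cert 3 1 [] ∷ cert 11 1 [] ∷ cert 643 1 [] ∷ cert 231967 1 [] ∷ cert 153372403920866888941 2 (cert 2 1 [] ∷ cert 2 1 [] ∷ cert 3 1 [] ∷ cert 5 1 [] ∷ cert 7 1 [] ∷ cert 13 1 [] ∷ cert 23 1 [] ∷ cert 1221312342099593 3 (cert 2 1 [] ∷ cert 2 1 [] ∷ cert 2 1 [] ∷ cert 152664042762449 3 (cert 2 1 [] ∷ cert 2 1 [] ∷ cert 2 1 [] ∷ cert 2 1 [] ∷ cert 7 1 [] ∷ cert 173699 1 [] ∷ cert 7847321 1 [] ∷ []) ∷ []) ∷ []) ∷ []) ∷ []))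
  ∷ row 325 33 (cert 4613679391936953610429590532014122532260339739644049093601 7 (cert 2 1 [] ∷ cert 2 1 [] ∷ cert 2 1 [] ∷ cert 2 1 [] ∷ cert 2 1 [] ∷ cert 3 1 [] ∷ cert 5 1 [] ∷ cert 5 1 [] ∷ cert 13 1 [] ∷ cert 97 1 [] ∷ cert 1524477726651121335722175037012332319673651777572049 3 (cert 2 1 [] ∷ cert 2 1 [] ∷ cert 2 1 [] ∷ cert 2 1 [] ∷ cert 13 1 [] ∷ cert 6555443 1 [] ∷ cert 63445607 5 (cert 2 1 [] ∷ cert 7 1 [] ∷ cert 4531829 1 [] ∷ []) ∷ cert 5827356881 7 (cert 2 1 [] ∷ cert 2 1 [] ∷ cert 2 1 [] ∷ cert 2 1 [] ∷ cert 5 1 [] ∷ cert 89 1 [] ∷ cert 881 1 [] ∷ cert 929 1 [] ∷ []) ∷ cert 3024005175772370113560701 2 (cert 2 1 [] ∷ cert 2 1 [] ∷ cert 5 1 [] ∷ cert 5 1 [] ∷ cert 31 1 [] ∷ cert 1597 1 [] ∷ cert 462437 1 [] ∷ cert 1320879941273 3 (cert 2 1 [] ∷ cert 2 1 [] ∷ cert 2 1 [] ∷ cert 23 1 [] ∷ cert 563 1 [] ∷ cert 2857 1 [] ∷ cert 4463 1 [] ∷ []) ∷ []) ∷ []) ∷ []))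
  ∷ row 455 74 (cert 4774797453608343803270988984332214098351782527747577456028391624903856636676854631 7 (cert 2 1 [] ∷ cert 5 1 [] ∷ cert 7 1 [] ∷ cert 13 1 [] ∷ cert 2731228072514455036231 12 (cert 2 1 [] ∷ cert 3 1 [] ∷ cert 3 1 [] ∷ cert 3 1 [] ∷ cert 3 1 [] ∷ cert 5 1 [] ∷ cert 2143 1 [] ∷ cert 1531333 1 [] ∷ cert 1027498357 5 (cert 2 1 [] ∷ cert 2 1 [] ∷ cert 3 1 [] ∷ cert 3 1 [] ∷ cert 137 1 [] ∷ cert 208333 1 [] ∷ []) ∷ []) ∷ cert 1921124867455611536531228169570389024215024419465348666403 2 (cert 2 1 [] ∷ cert 3 1 [] ∷ cert 3 1 [] ∷ cert 3 1 [] ∷ cert 492938503721 3 (cert 2 1 [] ∷ cert 2 1 [] ∷ cert 2 1 [] ∷ cert 5 1 [] ∷ cert 13 1 [] ∷ cert 13 1 [] ∷ cert 72919897 5 (cert 2 1 [] ∷ cert 2 1 [] ∷ cert 2 1 [] ∷ cert 3 1 [] ∷ cert 7 1 [] ∷ cert 37 1 [] ∷ cert 11731 1 [] ∷ []) ∷ []) ∷ cert 19519081344047 5 (cert 2 1 [] ∷ cert 677 1 [] ∷ cert 14415865099 2 (cert 2 1 [] ∷ cert 3 1 [] ∷ cert 19 1 [] ∷ cert 47 1 [] ∷ cert 2690531 1 [] ∷ []) ∷ []) ∷ cert 3697513066267412518744319829349 2 (cert 2 1 [] ∷ cert 2 1 [] ∷ cert 3 1 [] ∷ cert 3 1 [] ∷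 cert 13 1 [] ∷ cert 41 1 [] ∷ cert 41 1 [] ∷ cert 543289 1 [] ∷ cert 160249079 11 (cert 2 1 [] ∷ cert 11 1 [] ∷ cert 19 1 [] ∷ cert 383371 1 [] ∷ []) ∷ cert 53984576251 3 (cert 2 1 [] ∷ cert 3 1 [] ∷ cert 3 1 [] ∷ cert 3 1 [] ∷ cert 3 1 [] ∷ cert 3 1 [] ∷ cert 5 1 [] ∷ cert 5 1 [] ∷ cert 5 1 [] ∷ cert 5 1 [] ∷ cert 11 1 [] ∷ cert 107 1 [] ∷ cert 151 1 [] ∷ []) ∷ []) ∷ []) ∷ []))
  ∷ row 693 309 (cert 3225949575089611556532995773813585269068981944367719218489696982054779837928902323497 26 (cert 2 1 [] ∷ cert 2 1 [] ∷ cert 2 1 [] ∷ cert 3 1 [] ∷ cert 3 1 [] ∷ cert 7 1 [] ∷ cert 11 1 [] ∷ cert 59 1 [] ∷ cert 1790402131266701432527 3 (cert 2 1 [] ∷ cert 3 1 [] ∷ cert 3 1 [] ∷ cert 1201 1 [] ∷ cert 57343591 6 (cert 2 1 [] ∷ cert 3 1 [] ∷ cert 3 1 [] ∷ cert 5 1 [] ∷ cert 89 1 [] ∷ cert 7159 1 [] ∷ []) ∷ cert 1444275977 3 (cert 2 1 [] ∷ cert 2 1 [] ∷ cert 2 1 [] ∷ cert 11 1 [] ∷ cert 13 1 [] ∷ cert 1262479 1 [] ∷ []) ∷ []) ∷ cert 5508479724497696230965937935075373395778165582145379398413 5 (cert 2 1 [] ∷ cert 2 1 [] ∷ cert 3 1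 [] ∷ cert 103 1 [] ∷ cert 3571 1 [] ∷ cert 43398642710099 2 (cert 2 1 [] ∷ cert 13 1 [] ∷ cert 560561 1 [] ∷ cert 2977693 1 [] ∷ []) ∷ cert 28757245638579629792513958128067309023 5 (cert 2 1 [] ∷ cert 239 1 [] ∷ cert 14321 1 [] ∷ cert 4200935811350512530025683985169 3 (cert 2 1 [] ∷ cert 2 1 [] ∷ cert 2 1 [] ∷ cert 2 1 [] ∷ cert 173 1 [] ∷ cert 76631 1 [] ∷ cert 12547059017 3 (cert 2 1 [] ∷ cert 2 1 [] ∷ cert 2 1 [] ∷ cert 1568382377 3 (cert 2 1 [] ∷ cert 2 1 [] ∷ cert 2 1 [] ∷ cert 11 1 [] ∷ cert 181 1 [] ∷ cert 98467 1 [] ∷ []) ∷ []) ∷ cert 1578459801563 2 (cert 2 1 [] ∷ cert 7 1 [] ∷ cert 7 1 [] ∷ cert 16106732669 2 (cert 2 1 [] ∷ cert 2 1 [] ∷ cert 13 1 [] ∷ cert 19 1 [] ∷ cert 19 1 [] ∷ cert 79 1 [] ∷ cert 10861 1 [] ∷ []) ∷ []) ∷ []) ∷ []) ∷ []) ∷ []))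
  ∷ row 715 305 (cert 40437156024702109576962112690515640573348784018939257192870865875822732631168387328482154414164150624064713711 7 (cert 2 1 [] ∷ cert 5 1 [] ∷ cert 7 1 [] ∷ cert 11 1 [] ∷ cert 13 1 [] ∷ cert 23 1 [] ∷ cert 8923 1 [] ∷ cert 566227111 7 (cert 2 1 [] ∷ cert 3 1 [] ∷ cert 5 1 [] ∷ cert 23 1 [] ∷ cert 820619 1 [] ∷ []) ∷ cert 846324907417245937 5 (cert 2 1 [] ∷ cert 2 1 [] ∷ cert 2 1 [] ∷ cert 2 1 [] ∷ cert 3 1 [] ∷ cert 17 1 [] ∷ cert 1037162876736821 2 (cert 2 1 [] ∷ cert 2 1 [] ∷ cert 5 1 [] ∷ cert 131 1 [] ∷ cert 395863693411 2 (cert 2 1 [] ∷ cert 3 1 [] ∷ cert 5 1 [] ∷ cert 13195456447 3 (cert 2 1 [] ∷ cert 3 1 [] ∷ cert 37 1 [] ∷ cert 59438993 3 (cert 2 1 [] ∷ cert 2 1 [] ∷ cert 2 1 [] ∷ cert 2 1 [] ∷ cert 19 1 [] ∷ cert 23 1 [] ∷ cert 8501 1 [] ∷ []) ∷ []) ∷ []) ∷ []) ∷ []) ∷ cert 40284975226319741641 14 (cert 2 1 [] ∷ cert 2 1 [] ∷ cert 2 1 [] ∷ cert 3 1 [] ∷ cert 5 1 [] ∷ cert 47 1 [] ∷ cert 7142726103957401 7 (cert 2 1 [] ∷ cert 2 1 [] ∷ cert 2 1 [] ∷ cert 5 1 [] ∷ cert 5 1 [] ∷ cert 11 1 [] ∷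 cert 53 1 [] ∷ cert 137 1 [] ∷ cert 447141397 2 (cert 2 1 [] ∷ cert 2 1 [] ∷ cert 3 1 [] ∷ cert 13 1 [] ∷ cert 31 1 [] ∷ cert 92461 1 [] ∷ []) ∷ []) ∷ []) ∷ cert 1019616639764261062495298752961916471845855737274785777 10 (cert 2 1 [] ∷ cert 2 1 [] ∷ cert 2 1 [] ∷ cert 2 1 [] ∷ cert 3 1 [] ∷ cert 7 1 [] ∷ cert 27531078185639867899 3 (cert 2 1 [] ∷ cert 3 1 [] ∷ cert 24533 1 [] ∷ cert 187034322379651 2 (cert 2 1 [] ∷ cert 3 1 [] ∷ cert 5 1 [] ∷ cert 5 1 [] ∷ cert 163 1 [] ∷ cert 229 1 [] ∷ cert 33404653 5 (cert 2 1 [] ∷ cert 2 1 [] ∷ cert 3 1 [] ∷ cert 3 1 [] ∷ cert 509 1 [] ∷ cert 1823 1 [] ∷ []) ∷ []) ∷ []) ∷ cert 110223555800097730084393417422809 3 (cert 2 1 [] ∷ cert 2 1 [] ∷ cert 2 1 [] ∷ cert 7 1 [] ∷ cert 823 1 [] ∷ cert 2391589042703040489593677691 2 (cert 2 1 [] ∷ cert 5 1 [] ∷ cert 11 1 [] ∷ cert 11 1 [] ∷ cert 73 1 [] ∷ cert 35746679 11 (cert 2 1 [] ∷ cert 11 1 [] ∷ cert 1624849 1 [] ∷ []) ∷ cert 757430212120367 5 (cert 2 1 [] ∷ cert 131 1 [] ∷ cert 2890955008093 2 (cert 2 1 [] ∷ cert 2 1 [] ∷ cert 3 1 [] ∷ cert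 23 1 [] ∷ cert 2693 1 [] ∷ cert 3889519 1 [] ∷ []) ∷ []) ∷ []) ∷ []) ∷ []) ∷ []))
  ∷ []

covering : CoverTree 173
covering = node 3
    ( node 5
        ( node 11
            ( leaf (# 155) ∷ leaf (# 61)
            ∷ node 5
                ( node 7
                    ( leaf (# 49) ∷ leaf (# 98) ∷ leaf (# 11) ∷ leaf (# 78) ∷ leaf (# 7)
                    ∷ node 3
                        ( leaf (# 63) ∷ node 3 (leaf (# 70) ∷ leaf (# 158) ∷ leaf (# 125) ∷ []) ∷ leaf (# 40)
                        ∷ [])
                    ∷ leaf (# 32)
                    ∷ [])
                ∷ leaf (# 136) ∷ leaf (# 152) ∷ leaf (# 164) ∷ leaf (# 129)
                ∷ [])
            ∷ node 7
                ( leaf (# 162) ∷ leaf (# 11)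
                ∷ node 3
                    ( leaf (# 63) ∷ leaf (# 40) ∷ node 3 (leaf (# 158) ∷ leaf (# 70) ∷ leaf (# 125) ∷ [])
                    ∷ [])
                ∷ node 3 (leaf (# 66) ∷ leaf (# 171) ∷ leaf (# 65) ∷ []) ∷ leaf (# 7) ∷ leaf (# 49)
                ∷ leaf (# 167)
                ∷ [])
            ∷ leaf (# 52)
            ∷ node 7
                ( leaf (# 7) ∷ leaf (# 49) ∷ leaf (# 38) ∷ leaf (# 143) ∷ leaf (# 11)
                ∷ node 3
                    ( leaf (# 40) ∷ node 3 (leaf (# 125) ∷ leaf (# 158) ∷ leaf (# 70) ∷ []) ∷ leaf (# 63)
                    ∷ [])
                ∷ node 3 (leaf (# 132) ∷ leaf (# 65) ∷ leaf (# 66) ∷ [])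
                ∷ [])
            ∷ leaf (# 22)
            ∷ node 7
                ( leaf (# 11)
                ∷ node 3
                    ( leaf (# 40) ∷ node 3 (leaf (# 70) ∷ leaf (# 33) ∷ leaf (# 158) ∷ []) ∷ leaf (# 63)
                    ∷ [])
                ∷ node 3 (leaf (# 95) ∷ leaf (# 65) ∷ leaf (# 66) ∷ []) ∷ leaf (# 7) ∷ leaf (# 49)
                ∷ leaf (# 122) ∷ leaf (# 12)
                ∷ [])
            ∷ leaf (# 15) ∷ leaf (# 1) ∷ leaf (# 6)
            ∷ [])
        ∷ node 5
            ( leaf (# 13) ∷ leaf (# 41)
            ∷ node 7
                ( leaf (# 7) ∷ leaf (# 154) ∷ leaf (# 37) ∷ leaf (# 25)
                ∷ node 3
                    ( leaf (# 40)
                    ∷ node 3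
                        ( leaf (# 70)
                        ∷ node 13
                            ( leaf (# 111) ∷ leaf (# 84) ∷ leaf (# 81) ∷ leaf (# 169) ∷ leaf (# 68)
                            ∷ leaf (# 146) ∷ leaf (# 121) ∷ leaf (# 60) ∷ leaf (# 118) ∷ leaf (# 31)
                            ∷ leaf (# 85) ∷ leaf (# 126) ∷ leaf (# 29)
                            ∷ [])
                        ∷ leaf (# 158)
                        ∷ [])
                    ∷ leaf (# 63)
                    ∷ [])
                ∷ leaf (# 86) ∷ leaf (# 11)
                ∷ [])
            ∷ leaf (# 19) ∷ leaf (# 77)
            ∷ [])
        ∷ leaf (# 2)
        ∷ node 7
            ( leaf (# 46) ∷ leaf (# 36)
            ∷ node 3
                ( node 3
                    ( leaf (# 158)
                    ∷ node 11
                        ( leaf (# 112)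
                        ∷ node 5 (leaf (# 26) ∷ leaf (# 88) ∷ leaf (# 71) ∷ leaf (# 104) ∷ leaf (# 109) ∷ [])
                        ∷ leaf (# 24)
                        ∷ node 5 (leaf (# 71) ∷ leaf (# 104) ∷ leaf (# 109) ∷ leaf (# 134) ∷ leaf (# 88) ∷ [])
                        ∷ leaf (# 80) ∷ leaf (# 124) ∷ leaf (# 6) ∷ leaf (# 33) ∷ leaf (# 74) ∷ leaf (# 61)
                        ∷ leaf (# 1)
                        ∷ [])
                    ∷ leaf (# 70)
                    ∷ [])
                ∷ leaf (# 40) ∷ leaf (# 63)
                ∷ [])
            ∷ leaf (# 7) ∷ leaf (# 43) ∷ leaf (# 11) ∷ leaf (# 3)
            ∷ [])
        ∷ leaf (# 8)
        ∷ [])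
    ∷ node 3
        ( node 5
            ( leaf (# 2) ∷ leaf (# 35)
            ∷ node 13
                ( leaf (# 103) ∷ leaf (# 17)
                ∷ node 7
                    ( leaf (# 148) ∷ leaf (# 3) ∷ leaf (# 7) ∷ leaf (# 46) ∷ leaf (# 91) ∷ leaf (# 161)
                    ∷ leaf (# 90)
                    ∷ [])
                ∷ leaf (# 142) ∷ leaf (# 31) ∷ leaf (# 5) ∷ leaf (# 159) ∷ leaf (# 151) ∷ leaf (# 100)
                ∷ node 7
                    ( leaf (# 51) ∷ leaf (# 3) ∷ leaf (# 7) ∷ leaf (# 46) ∷ leaf (# 107) ∷ leaf (# 161)
                    ∷ leaf (# 133)
                    ∷ [])
                ∷ leaf (# 39) ∷ leaf (# 28) ∷ leaf (# 45)
                ∷ [])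
            ∷ node 5
                ( leaf (# 13) ∷ leaf (# 19) ∷ leaf (# 62) ∷ leaf (# 44)
                ∷ node 13
                    ( leaf (# 45) ∷ leaf (# 31) ∷ leaf (# 135) ∷ leaf (# 17) ∷ leaf (# 126) ∷ leaf (# 28)
                    ∷ leaf (# 20) ∷ leaf (# 111) ∷ leaf (# 103) ∷ leaf (# 5) ∷ leaf (# 39)
                    ∷ node 7
                        ( leaf (# 86) ∷ leaf (# 37) ∷ leaf (# 90) ∷ leaf (# 91) ∷ leaf (# 7) ∷ leaf (# 148)
                        ∷ leaf (# 154)
                        ∷ [])
                    ∷ leaf (# 29)
                    ∷ [])
                ∷ [])
            ∷ leaf (# 14)
            ∷ [])
        ∷ node 11
            ( node 3 (leaf (# 75) ∷ leaf (# 55) ∷ leaf (# 166) ∷ [])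
            ∷ node 5
                ( node 5
                    ( leaf (# 97)
                    ∷ node 13
                        ( node 3 (leaf (# 55) ∷ leaf (# 138) ∷ leaf (# 128) ∷ [])
                        ∷ node 3 (leaf (# 83) ∷ leaf (# 72) ∷ leaf (# 55) ∷ []) ∷ leaf (# 20) ∷ leaf (# 126)
                        ∷ leaf (# 135) ∷ leaf (# 45)
                        ∷ node 7
                            ( leaf (# 90) ∷ leaf (# 154) ∷ leaf (# 91) ∷ leaf (# 86) ∷ leaf (# 7) ∷ leaf (# 37)
                            ∷ leaf (# 148)
                            ∷ [])
                        ∷ leaf (# 5) ∷ leaf (# 87) ∷ leaf (# 169)
                        ∷ node 3 (leaf (# 150) ∷ leaf (# 58) ∷ leaf (# 55) ∷ []) ∷ leaf (# 31) ∷ leaf (# 29)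
                        ∷ [])
                    ∷ leaf (# 13) ∷ leaf (# 19) ∷ leaf (# 137)
                    ∷ [])
                ∷ node 3 (leaf (# 10) ∷ leaf (# 57) ∷ leaf (# 55) ∷ []) ∷ leaf (# 2) ∷ leaf (# 22)
                ∷ node 7
                    ( leaf (# 117) ∷ leaf (# 3)
                    ∷ node 13
                        ( leaf (# 107) ∷ leaf (# 87) ∷ leaf (# 59) ∷ leaf (# 159) ∷ leaf (# 5) ∷ leaf (# 31)
                        ∷ leaf (# 16) ∷ leaf (# 91) ∷ node 3 (leaf (# 150) ∷ leaf (# 55) ∷ leaf (# 58) ∷ [])
                        ∷ node 3 (leaf (# 55) ∷ leaf (# 23) ∷ leaf (# 83) ∷ []) ∷ leaf (# 45) ∷ leaf (# 163)
                        ∷ node 3 (leaf (# 55) ∷ leaf (# 128) ∷ leaf (# 138) ∷ [])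
                        ∷ [])
                    ∷ node 13
                        ( leaf (# 170) ∷ leaf (# 159) ∷ leaf (# 5) ∷ leaf (# 31) ∷ leaf (# 131) ∷ leaf (# 148)
                        ∷ node 3 (leaf (# 58) ∷ leaf (# 150) ∷ leaf (# 55) ∷ [])
                        ∷ node 3 (leaf (# 83) ∷ leaf (# 55) ∷ leaf (# 23) ∷ []) ∷ leaf (# 45) ∷ leaf (# 163)
                        ∷ node 3 (leaf (# 138) ∷ leaf (# 55) ∷ leaf (# 128) ∷ []) ∷ leaf (# 51) ∷ leaf (# 87)
                        ∷ [])
                    ∷ leaf (# 46)
                    ∷ node 13
                        ( node 5 (leaf (# 168) ∷ leaf (# 108) ∷ leaf (# 94) ∷ leaf (# 34) ∷ leaf (# 30) ∷ [])
                        ∷ leaf (# 90) ∷ node 3 (leaf (# 150) ∷ leaf (# 55) ∷ leaf (# 58) ∷ [])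
                        ∷ node 3 (leaf (# 55) ∷ leaf (# 23) ∷ leaf (# 83) ∷ []) ∷ leaf (# 45) ∷ leaf (# 163)
                        ∷ node 3 (leaf (# 55) ∷ leaf (# 128) ∷ leaf (# 138) ∷ []) ∷ leaf (# 133) ∷ leaf (# 87)
                        ∷ node 5 (leaf (# 120) ∷ leaf (# 30) ∷ leaf (# 168) ∷ leaf (# 54) ∷ leaf (# 94) ∷ [])
                        ∷ leaf (# 159) ∷ leaf (# 5) ∷ leaf (# 31)
                        ∷ [])
                    ∷ leaf (# 7)
                    ∷ [])
                ∷ [])
            ∷ leaf (# 50)
            ∷ node 5
                ( leaf (# 2) ∷ leaf (# 18)
                ∷ node 7
                    ( leaf (# 7) ∷ leaf (# 143) ∷ leaf (# 3)
                    ∷ node 13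
                        ( leaf (# 16) ∷ leaf (# 91) ∷ node 3 (leaf (# 58) ∷ leaf (# 150) ∷ leaf (# 55) ∷ [])
                        ∷ node 3 (leaf (# 83) ∷ leaf (# 55) ∷ leaf (# 23) ∷ []) ∷ leaf (# 45) ∷ leaf (# 163)
                        ∷ node 3 (leaf (# 138) ∷ leaf (# 55) ∷ leaf (# 128) ∷ []) ∷ leaf (# 107) ∷ leaf (# 106)
                        ∷ leaf (# 59) ∷ leaf (# 159) ∷ leaf (# 5) ∷ leaf (# 31)
                        ∷ [])
                    ∷ node 13
                        ( node 3 (leaf (# 55) ∷ leaf (# 58) ∷ leaf (# 150) ∷ [])
                        ∷ node 3 (leaf (# 23) ∷ leaf (# 83) ∷ leaf (# 55) ∷ []) ∷ leaf (# 45) ∷ leaf (# 163)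
                        ∷ node 3 (leaf (# 128) ∷ leaf (# 138) ∷ leaf (# 55) ∷ []) ∷ leaf (# 51) ∷ leaf (# 106)
                        ∷ leaf (# 170) ∷ leaf (# 159) ∷ leaf (# 5) ∷ leaf (# 31) ∷ leaf (# 131) ∷ leaf (# 148)
                        ∷ [])
                    ∷ leaf (# 46)
                    ∷ node 13
                        ( node 3 (leaf (# 138) ∷ leaf (# 55) ∷ leaf (# 128) ∷ []) ∷ leaf (# 133) ∷ leaf (# 106)
                        ∷ node 5 (leaf (# 120) ∷ leaf (# 30) ∷ leaf (# 168) ∷ leaf (# 54) ∷ leaf (# 94) ∷ [])
                        ∷ leaf (# 159) ∷ leaf (# 5) ∷ leaf (# 31)
                        ∷ node 5 (leaf (# 108) ∷ leaf (# 94) ∷ leaf (# 34) ∷ leaf (# 30) ∷ leaf (# 168) ∷ [])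
                        ∷ leaf (# 90) ∷ node 3 (leaf (# 150) ∷ leaf (# 55) ∷ leaf (# 58) ∷ [])
                        ∷ node 3 (leaf (# 55) ∷ leaf (# 23) ∷ leaf (# 83) ∷ []) ∷ leaf (# 45) ∷ leaf (# 163)
                        ∷ [])
                    ∷ [])
                ∷ node 5
                    ( leaf (# 13) ∷ leaf (# 19) ∷ leaf (# 137) ∷ leaf (# 97)
                    ∷ node 13
                        ( leaf (# 169) ∷ node 3 (leaf (# 58) ∷ leaf (# 55) ∷ leaf (# 150) ∷ []) ∷ leaf (# 31)
                        ∷ leaf (# 29) ∷ node 3 (leaf (# 128) ∷ leaf (# 55) ∷ leaf (# 138) ∷ [])
                        ∷ node 3 (leaf (# 55) ∷ leaf (# 83) ∷ leaf (# 72) ∷ []) ∷ leaf (# 20) ∷ leaf (# 126)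
                        ∷ leaf (# 135) ∷ leaf (# 45)
                        ∷ node 7
                            ( leaf (# 143) ∷ leaf (# 91) ∷ leaf (# 86) ∷ leaf (# 7) ∷ leaf (# 37) ∷ leaf (# 148)
                            ∷ leaf (# 90)
                            ∷ [])
                        ∷ leaf (# 5) ∷ leaf (# 106)
                        ∷ [])
                    ∷ [])
                ∷ node 3 (leaf (# 55) ∷ leaf (# 10) ∷ leaf (# 57) ∷ [])
                ∷ [])
            ∷ leaf (# 6)
            ∷ node 5
                ( node 7
                    ( node 13
                        ( leaf (# 5) ∷ leaf (# 31)
                        ∷ node 5 (leaf (# 108) ∷ leaf (# 94) ∷ leaf (# 34) ∷ leaf (# 30) ∷ leaf (# 168) ∷ [])
                        ∷ leaf (# 90) ∷ node 3 (leaf (# 58) ∷ leaf (# 150) ∷ leaf (# 55) ∷ [])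
                        ∷ node 3 (leaf (# 83) ∷ leaf (# 55) ∷ leaf (# 23) ∷ []) ∷ leaf (# 45) ∷ leaf (# 163)
                        ∷ node 3 (leaf (# 138) ∷ leaf (# 55) ∷ leaf (# 128) ∷ []) ∷ leaf (# 133) ∷ leaf (# 149)
                        ∷ node 5 (leaf (# 30) ∷ leaf (# 168) ∷ leaf (# 54) ∷ leaf (# 94) ∷ leaf (# 120) ∷ [])
                        ∷ leaf (# 159)
                        ∷ [])
                    ∷ leaf (# 7) ∷ leaf (# 21) ∷ leaf (# 3)
                    ∷ node 13
                        ( node 3 (leaf (# 128) ∷ leaf (# 138) ∷ leaf (# 55) ∷ []) ∷ leaf (# 107) ∷ leaf (# 149)
                        ∷ leaf (# 59) ∷ leaf (# 159) ∷ leaf (# 5) ∷ leaf (# 31) ∷ leaf (# 16) ∷ leaf (# 91)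
                        ∷ node 3 (leaf (# 58) ∷ leaf (# 150) ∷ leaf (# 55) ∷ [])
                        ∷ node 3 (leaf (# 83) ∷ leaf (# 55) ∷ leaf (# 23) ∷ []) ∷ leaf (# 45) ∷ leaf (# 163)
                        ∷ [])
                    ∷ node 13
                        ( leaf (# 149) ∷ leaf (# 170) ∷ leaf (# 159) ∷ leaf (# 5) ∷ leaf (# 31) ∷ leaf (# 131)
                        ∷ leaf (# 148) ∷ node 3 (leaf (# 55) ∷ leaf (# 58) ∷ leaf (# 150) ∷ [])
                        ∷ node 3 (leaf (# 23) ∷ leaf (# 83) ∷ leaf (# 55) ∷ []) ∷ leaf (# 45) ∷ leaf (# 163)
                        ∷ node 3 (leaf (# 128) ∷ leaf (# 138) ∷ leaf (# 55) ∷ []) ∷ leaf (# 51)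
                        ∷ [])
                    ∷ leaf (# 46)
                    ∷ [])
                ∷ node 5
                    ( leaf (# 19) ∷ leaf (# 137) ∷ leaf (# 97)
                    ∷ node 13
                        ( leaf (# 135) ∷ leaf (# 45)
                        ∷ node 7
                            ( leaf (# 154) ∷ leaf (# 91) ∷ leaf (# 86) ∷ leaf (# 7) ∷ leaf (# 37) ∷ leaf (# 148)
                            ∷ leaf (# 90)
                            ∷ [])
                        ∷ leaf (# 5) ∷ leaf (# 111) ∷ leaf (# 169)
                        ∷ node 3 (leaf (# 150) ∷ leaf (# 58) ∷ leaf (# 55) ∷ []) ∷ leaf (# 31) ∷ leaf (# 29)
                        ∷ node 3 (leaf (# 138) ∷ leaf (# 128) ∷ leaf (# 55) ∷ [])
                        ∷ node 3 (leaf (# 72) ∷ leaf (# 55) ∷ leaf (# 83) ∷ []) ∷ leaf (# 20) ∷ leaf (# 126)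
                        ∷ [])
                    ∷ leaf (# 13)
                    ∷ [])
                ∷ node 3 (leaf (# 10) ∷ leaf (# 57) ∷ leaf (# 55) ∷ []) ∷ leaf (# 2) ∷ leaf (# 52)
                ∷ [])
            ∷ leaf (# 1) ∷ leaf (# 9)
            ∷ node 5
                ( leaf (# 2) ∷ leaf (# 15)
                ∷ node 7
                    ( leaf (# 3)
                    ∷ node 13
                        ( leaf (# 113) ∷ leaf (# 59) ∷ leaf (# 159) ∷ leaf (# 5) ∷ leaf (# 31) ∷ leaf (# 16)
                        ∷ leaf (# 91) ∷ node 3 (leaf (# 55) ∷ leaf (# 58) ∷ leaf (# 150) ∷ [])
                        ∷ node 3 (leaf (# 23) ∷ leaf (# 83) ∷ leaf (# 55) ∷ []) ∷ leaf (# 45) ∷ leaf (# 163)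
                        ∷ node 3 (leaf (# 128) ∷ leaf (# 138) ∷ leaf (# 55) ∷ []) ∷ leaf (# 107)
                        ∷ [])
                    ∷ node 13
                        ( leaf (# 159) ∷ leaf (# 5) ∷ leaf (# 31) ∷ leaf (# 131) ∷ leaf (# 148)
                        ∷ node 3 (leaf (# 150) ∷ leaf (# 55) ∷ leaf (# 58) ∷ [])
                        ∷ node 3 (leaf (# 55) ∷ leaf (# 23) ∷ leaf (# 83) ∷ []) ∷ leaf (# 45) ∷ leaf (# 163)
                        ∷ node 3 (leaf (# 55) ∷ leaf (# 128) ∷ leaf (# 138) ∷ []) ∷ leaf (# 51) ∷ leaf (# 113)
                        ∷ leaf (# 170)
                        ∷ [])
                    ∷ leaf (# 46)
                    ∷ node 5
                        ( node 13
                            ( leaf (# 90) ∷ node 3 (leaf (# 128) ∷ leaf (# 55) ∷ leaf (# 138) ∷ []) ∷ leaf (# 5)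
                            ∷ node 3 (leaf (# 83) ∷ leaf (# 23) ∷ leaf (# 55) ∷ []) ∷ leaf (# 113)
                            ∷ leaf (# 108) ∷ leaf (# 163) ∷ leaf (# 159)
                            ∷ node 3 (leaf (# 55) ∷ leaf (# 150) ∷ leaf (# 58) ∷ []) ∷ leaf (# 133)
                            ∷ leaf (# 31) ∷ leaf (# 45) ∷ leaf (# 54)
                            ∷ [])
                        ∷ leaf (# 47) ∷ leaf (# 168) ∷ leaf (# 94) ∷ leaf (# 30)
                        ∷ [])
                    ∷ leaf (# 7) ∷ leaf (# 102)
                    ∷ [])
                ∷ node 5
                    ( leaf (# 19) ∷ leaf (# 137) ∷ leaf (# 97)
                    ∷ node 13
                        ( node 3 (leaf (# 55) ∷ leaf (# 150) ∷ leaf (# 58) ∷ []) ∷ leaf (# 31) ∷ leaf (# 29)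
                        ∷ node 3 (leaf (# 55) ∷ leaf (# 138) ∷ leaf (# 128) ∷ [])
                        ∷ node 3 (leaf (# 83) ∷ leaf (# 72) ∷ leaf (# 55) ∷ []) ∷ leaf (# 20) ∷ leaf (# 126)
                        ∷ leaf (# 135) ∷ leaf (# 45)
                        ∷ node 7
                            ( leaf (# 148) ∷ leaf (# 90) ∷ leaf (# 154) ∷ leaf (# 91) ∷ leaf (# 86) ∷ leaf (# 7)
                            ∷ leaf (# 37)
                            ∷ [])
                        ∷ leaf (# 5) ∷ leaf (# 111) ∷ leaf (# 169)
                        ∷ [])
                    ∷ leaf (# 13)
                    ∷ [])
                ∷ node 3 (leaf (# 57) ∷ leaf (# 55) ∷ leaf (# 10) ∷ [])
                ∷ [])
            ∷ node 13
                ( node 5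
                    ( leaf (# 144) ∷ node 3 (leaf (# 55) ∷ leaf (# 10) ∷ leaf (# 57) ∷ []) ∷ leaf (# 163)
                    ∷ leaf (# 2)
                    ∷ node 5 (leaf (# 169) ∷ leaf (# 137) ∷ leaf (# 13) ∷ leaf (# 97) ∷ leaf (# 19) ∷ [])
                    ∷ [])
                ∷ leaf (# 115) ∷ leaf (# 5) ∷ leaf (# 53) ∷ leaf (# 45)
                ∷ node 7
                    ( leaf (# 107) ∷ leaf (# 7)
                    ∷ node 5
                        ( leaf (# 51)
                        ∷ node 5 (leaf (# 97) ∷ leaf (# 114) ∷ leaf (# 13) ∷ leaf (# 19) ∷ leaf (# 137) ∷ [])
                        ∷ node 3 (leaf (# 10) ∷ leaf (# 57) ∷ leaf (# 55) ∷ []) ∷ leaf (# 2) ∷ leaf (# 127)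
                        ∷ [])
                    ∷ leaf (# 27)
                    ∷ node 5
                        ( node 5 (leaf (# 13) ∷ leaf (# 19) ∷ leaf (# 137) ∷ leaf (# 97) ∷ leaf (# 86) ∷ [])
                        ∷ node 3 (leaf (# 55) ∷ leaf (# 10) ∷ leaf (# 57) ∷ []) ∷ leaf (# 2) ∷ leaf (# 127)
                        ∷ leaf (# 46)
                        ∷ [])
                    ∷ node 5
                        ( leaf (# 127) ∷ leaf (# 3)
                        ∷ node 5 (leaf (# 37) ∷ leaf (# 13) ∷ leaf (# 19) ∷ leaf (# 137) ∷ leaf (# 97) ∷ [])
                        ∷ node 3 (leaf (# 55) ∷ leaf (# 10) ∷ leaf (# 57) ∷ []) ∷ leaf (# 2)
                        ∷ [])
                    ∷ leaf (# 133)
                    ∷ [])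
                ∷ node 5
                    ( leaf (# 159) ∷ leaf (# 2) ∷ leaf (# 126) ∷ leaf (# 140)
                    ∷ node 3 (leaf (# 55) ∷ leaf (# 10) ∷ leaf (# 57) ∷ [])
                    ∷ [])
                ∷ leaf (# 145)
                ∷ node 3
                    ( leaf (# 83)
                    ∷ node 5 (leaf (# 23) ∷ leaf (# 172) ∷ leaf (# 2) ∷ leaf (# 10) ∷ leaf (# 72) ∷ [])
                    ∷ leaf (# 55)
                    ∷ [])
                ∷ node 3 (leaf (# 128) ∷ leaf (# 55) ∷ leaf (# 138) ∷ []) ∷ leaf (# 64) ∷ leaf (# 31)
                ∷ node 3 (leaf (# 58) ∷ leaf (# 55) ∷ leaf (# 150) ∷ [])
                ∷ [])
            ∷ leaf (# 110)
            ∷ [])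
        ∷ leaf (# 4)
        ∷ [])
    ∷ leaf (# 0)
    ∷ [])

residues : Fin 173 → ℤ
residues s = + residue (lookup table s)

moduli : Fin 173 → ℕ
moduli s = modulus (lookup table s)

primes : Fin 173 → ℕ
primes s = primeDivisor (lookup table s)

rows-valid : Allᵥ.All (T ∘ rowCheck) table
rows-valid = from-yes (all? (T? ∘ rowCheck) table)

primes-increasing : AllPairs _<_ (mapᵥ primeDivisor table)
primes-increasing = from-yes (allPairs? _<?_ (mapᵥ primeDivisor table))

covering-valid : T (coversClass residues moduli 1 (+ 0) covering)
covering-valid = tt

primes-injective : Injective _≡_ _≡_ primes
primes-injective {i} {j} pᵢ≡pⱼ = lookup-injective (AllPairs.map <⇒≢ primes-increasing) i j
  (trans (lookup-map i primeDivisor table) (trans pᵢ≡pⱼ (sym (lookup-map j primeDivisor table))))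

theorem1p1 : Σ (Fin 173 → ℤ) λ a → Σ (Fin 173 → ℕ) λ n →
    (∀ s → 1 < n s × n s ∣ N) × Covers 173 a n ×
    Σ (Fin 173 → ℕ) λ p → Injective _≡_ _≡_ p ×
      (∀ s → 5 < p s × PrimitivePrimeDivisor (p s) (n s))
theorem1p1 = residues , moduli , (λ s → proj₁ (valid s) , proj₁ (proj₂ (valid s))) ,
             cover residues moduli covering covering-valid ,
             primes , primes-injective , (λ s → proj₂ (proj₂ (valid s)))
  where
  valid : ∀ s → ValidRow (lookup table s)
  valid s = rowCheck-sound (lookup table s) (lookup⁺ rows-valid s)
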